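{- Let $D$ be a diagonal matrix in Smith normal form and let $\mathcal{S}_1,\mathcal{S}_2$ be regular subsets of $\mathrm{GL}(2,\mathbb{Z})$ (given by finite automata). Then it is decidable whether there exist $A_1\in\mathcal{S}_1$ and $A_2\in\mathcal{S}_2$ such that $A_1DA_2=D$.
   Context: $\mathrm{GL}(2,\mathbb{Z})$ is the group of $2\times 2$ integer matrices with determinant $\pm1$. A diagonal matrix in Smith normal form is $D=\begin{bmatrix}t_1&0\\0&t_2\end{bmatrix}$ with integers $t_1\mid t_2$; here $D$ is nonsingular, i.e. $D=\begin{bmatrix}m&0\\0&mn\end{bmatrix}$ with $m,n\neq0$. Let $\Sigma=\{X,N,S,R\}$ and $\phi:\Sigma^*\to\mathrm{GL}(2,\mathbb{Z})$ the monoid morphism determined by $\phi(X)=\begin{bmatrix}-1&0\\0&-1\end{bmatrix}$, $\phi(N)=\begin{bmatrix}1&0\\0&-1\end{bmatrix}$, $\phi(S)=\begin{bmatrix}0&-1\\1&0\end{bmatrix}$, $\phi(R)=\begin{bmatrix}0&-1\\1&1\end{bmatrix}$. A subset $\mathcal{S}\subseteq\mathrm{GL}(2,\mathbb{Z})$ is regular if $\mathcal{S}=\phi(L)$ for some regular language $L\subseteq\Sigma^*$. -}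

module Defs where

open import Data.Nat using (ℕ)
open import Data.Fin using (Fin)
open import Data.Bool using (Bool; true)
open import Data.Integer using (ℤ; +_; -_; _+_; _*_; 0ℤ; 1ℤ)
open import Data.List using (List; []; _∷_)
open import Data.Product using (Σ; _×_; ∃)
open import Relation.Binary.PropositionalEquality using (_≡_)

-- 2×2 integer matrices  [ a b ; c d ]
record Mat2 : Set where
  constructor mat
  field
    a b c d : ℤ

infixl 7 _⊗_
_⊗_ : Mat2 → Mat2 → Mat2
mat a b c d ⊗ mat a' b' c' d' =
  mat (a * a' + b * c') (a * b' + b * d') (c * a' + d * c') (c * b' + d * d')

I₂ : Mat2
I₂ = mat 1ℤ 0ℤ 0ℤ 1ℤ

det : Mat2 → ℤ
det (mat a b c d) = a * d + (- (b * c))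

data Letter : Set where
  X N S R : Letter

φL : Letter → Mat2
φL X = mat (- 1ℤ) 0ℤ 0ℤ (- 1ℤ)
φL N = mat 1ℤ 0ℤ 0ℤ (- 1ℤ)
φL S = mat 0ℤ (- 1ℤ) 1ℤ 0ℤ
φL R = mat 0ℤ (- 1ℤ) 1ℤ 1ℤ

φ : List Letter → Mat2
φ [] = I₂
φ (x ∷ w) = φL x ⊗ φ w

record DFA : Set where
  field
    nStates : ℕ
    start   : Fin nStates
    δ       : Fin nStates → Letter → Fin nStates
    final   : Fin nStates → Bool

run : (A : DFA) → Fin (DFA.nStates A) → List Letter → Fin (DFA.nStates A)
run A q [] = q
run A q (x ∷ w) = run A (DFA.δ A q x) w

Accepts : DFA → List Letter → Set
Accepts A w = DFA.final A (run A (DFA.start A) w) ≡ true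

-- the regular subset φ(L(A)) ⊆ GL(2,ℤ), as a membership predicate
_∈φL_ : Mat2 → DFA → Set
M ∈φL A = Σ (List Letter) (λ w → Accepts A w × φ w ≡ M)

-- nonsingular diagonal matrix in Smith normal form diag(m, m n)
diagSNF : ℤ → ℤ → Mat2
diagSNF m n = mat m 0ℤ 0ℤ (m * n)

{-# OPTIONS --safe #-}
-- Dividing by m reduces the equation to A₁ · diag(1, n) · A₂ = diag(1, n). While a word
-- for A₂ is read letter by letter, diag(1, n) · (prefix) is kept in Hermite normal form
-- [a b; 0 d] up to left multiplication by GL(2,ℤ); as a·d = ±n there are finitely many
-- such forms, and at the end the form must be diag(1, ±n). So the question becomes
-- whether a finite graph, labelled by words over the generators, has a path with product I.
-- This is decided by saturating the set of triples (p, e, r) such that some path from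
-- p to r has product e, where e ranges over the two finite factors of the amalgam
-- GL(2,ℤ) = D₈ *_{D₄} D₁₂: adjacent letters from the same factor can be merged, and by
-- the normal form theorem (a ping-pong on the sum of absolute values of the entries)
-- an alternating product of two or more letters never lies in a factor.

module Submission where

open import Defs
open import Data.Bool using (Bool; true; false; T)
open import Data.Bool.Properties using (T?) renaming (_≟_ to _≟ᵇ_)
open import Data.Empty using (⊥-elim)
open import Data.Fin using (Fin; zero; suc; toℕ; fromℕ<)
import Data.Fin.Properties as Fin
open import Data.Integer using (ℤ; +_; -_; _+_; _-_; _*_; 0ℤ; 1ℤ; -[1+_]; ∣_∣; ≢-nonZero; _/_; _%_; _◃_; sign)
open import Data.Integer.DivMod using (a≡a%n+[a/n]*n; n%d<d)
open import Data.Integer.Properties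
  using (abs-*; *-cancelˡ-≡; *-cancelʳ-≡; ∣i∣≡0⇒i≡0; *-identityˡ; *-identityʳ; *-zeroˡ; *-zeroʳ; +-identityˡ; ∣-i∣≡∣i∣; ◃-inverse)
  renaming (_≟_ to _≟ℤ_)
open import Data.Integer.Tactic.RingSolver using (solve-∀)
open import Data.List using (List; []; _∷_; _++_; length; map; concat; concatMap; replicate; allFin; cartesianProduct; lookup; drop)
open import Data.List.Membership.Propositional using (_∈_; find; lose)
import Data.List.Membership.DecPropositional as DecMembership
open import Data.List.Membership.Propositional.Properties
  using (∈-allFin; ∈-cartesianProduct⁺; ∈-map⁺; ∈-map⁻; ∈-++⁺ˡ; ∈-++⁺ʳ; ∈-++⁻; ∈-concatMap⁺; ∈-concatMap⁻; ∈-lookup)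
open import Data.List.Relation.Unary.Any using (Any; here; there; any?; index; satisfied)
open import Data.List.Relation.Unary.Any.Properties using (lookup-index)
open import Data.Nat as ℕ using (ℕ; zero; suc; _≤_; _<_; s≤s; z≤n)
import Data.Nat.Properties as ℕ
open import Data.Nat.Divisibility using (∣⇒≤; divides)
import Data.Nat.Tactic.RingSolver as ℕ-Solver
open import Data.Product using (Σ; _×_; _,_; proj₁; proj₂; ∃)
open import Data.Product.Properties using (≡-dec; ,-injectiveˡ; ,-injectiveʳ)
open import Data.Sign using (Sign)
open import Data.Sign.Properties using () renaming (_≟_ to _≟ˢ_)
open import Data.Sum using (_⊎_; inj₁; inj₂)
import Data.Sum.Properties as Sum
open import Data.Unit using (⊤; tt)
open import Data.Unit.Properties using () renaming (_≟_ to _≟ᵘ_)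
open import Function.Bundles using (_⇔_; mk⇔; Equivalence)
open import Relation.Binary using (DecidableEquality)
open import Relation.Binary.PropositionalEquality
open import Relation.Nullary using (Dec; yes; no; ¬_)
open import Relation.Nullary.Decidable using (isYes; toWitness; fromWitness; map′; _×-dec_; _⊎-dec_; _→-dec_; ¬?)

mat-cong : ∀ {a b c d a' b' c' d'} → a ≡ a' → b ≡ b' → c ≡ c' → d ≡ d' → mat a b c d ≡ mat a' b' c' d'
mat-cong refl refl refl refl = refl

⊗-assoc : ∀ A B C → (A ⊗ B) ⊗ C ≡ A ⊗ (B ⊗ C)
⊗-assoc (mat a b c d) (mat e f g h) (mat i j k l) =
  mat-cong (entry a b e f g h i k) (entry a b e f g h j l) (entry c d e f g h i k) (entry c d e f g h j l)
  where
  entry : ∀ a b e f g h i k → (a * e + b * g) * i + (a * f + b * h) * k ≡ a * (e * i + f * k) + b * (g * i + h * k)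
  entry = solve-∀

⊗-identityˡ : ∀ A → I₂ ⊗ A ≡ A
⊗-identityˡ (mat a b c d) = mat-cong (first a c) (first b d) (second a c) (second b d)
  where
  first : ∀ x y → 1ℤ * x + 0ℤ * y ≡ x
  first = solve-∀
  second : ∀ x y → 0ℤ * x + 1ℤ * y ≡ y
  second = solve-∀

⊗-identityʳ : ∀ A → A ⊗ I₂ ≡ A
⊗-identityʳ (mat a b c d) = mat-cong (first a b) (second a b) (first c d) (second c d)
  where
  first : ∀ x y → x * 1ℤ + y * 0ℤ ≡ x
  first = solve-∀
  second : ∀ x y → x * 0ℤ + y * 1ℤ ≡ y
  second = solve-∀

det-⊗ : ∀ A B → det (A ⊗ B) ≡ det A * det B
det-⊗ (mat a b c d) (mat e f g h) = cauchy-binet a b c d e f g h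
  where
  cauchy-binet : ∀ a b c d e f g h →
    (a * e + b * g) * (c * f + d * h) + - ((a * f + b * h) * (c * e + d * g)) ≡ (a * d + - (b * c)) * (e * h + - (f * g))
  cauchy-binet = solve-∀

infix 4 _≟ₘ_
_≟ₘ_ : DecidableEquality Mat2
mat a b c d ≟ₘ mat a' b' c' d' with a ≟ℤ a' | b ≟ℤ b' | c ≟ℤ c' | d ≟ℤ d'
... | yes refl | yes refl | yes refl | yes refl = yes refl
... | no a≢   | _        | _        | _        = no λ { refl → a≢ refl }
... | yes _    | no b≢   | _        | _        = no λ { refl → b≢ refl }
... | yes _    | yes _    | no c≢   | _        = no λ { refl → c≢ refl }
... | yes _    | yes _    | yes _    | no d≢   = no λ { refl → d≢ refl }

-- An opaque copy of _⊗_: since Mat2 has η, unifying with an unfolded product of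
-- variables eta-expands it into large entry-wise terms.
opaque
  infixl 7 _·_
  _·_ : Mat2 → Mat2 → Mat2
  A · B = A ⊗ B

opaque
  unfolding _·_
  ·≡⊗ : ∀ A B → A · B ≡ A ⊗ B
  ·≡⊗ A B = refl

·-assoc : ∀ A B C → (A · B) · C ≡ A · (B · C)
·-assoc A B C = begin
  (A · B) · C   ≡⟨ ·≡⊗ (A · B) C ⟩
  (A · B) ⊗ C   ≡⟨ cong (_⊗ C) (·≡⊗ A B) ⟩
  (A ⊗ B) ⊗ C   ≡⟨ ⊗-assoc A B C ⟩
  A ⊗ (B ⊗ C)   ≡⟨ cong (A ⊗_) (·≡⊗ B C) ⟨
  A ⊗ (B · C)   ≡⟨ ·≡⊗ A (B · C) ⟨
  A · (B · C)   ∎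
  where open ≡-Reasoning

·-identityˡ : ∀ A → I₂ · A ≡ A
·-identityˡ A = trans (·≡⊗ I₂ A) (⊗-identityˡ A)

·-identityʳ : ∀ A → A · I₂ ≡ A
·-identityʳ A = trans (·≡⊗ A I₂) (⊗-identityʳ A)

det-· : ∀ A B → det (A · B) ≡ det A * det B
det-· A B = trans (cong det (·≡⊗ A B)) (det-⊗ A B)

φ-∷ : ∀ x w → φ (x ∷ w) ≡ φL x · φ w
φ-∷ x w = sym (·≡⊗ (φL x) (φ w))

φ-[_] : ∀ x → φ (x ∷ []) ≡ φL x
φ-[ x ] = trans (φ-∷ x []) (·-identityʳ (φL x))

φ-++ : ∀ u v → φ (u ++ v) ≡ φ u · φ v
φ-++ []      v = sym (·-identityˡ (φ v))
φ-++ (x ∷ u) v = begin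
  φ (x ∷ u ++ v)         ≡⟨ φ-∷ x (u ++ v) ⟩
  φL x · φ (u ++ v)      ≡⟨ cong (φL x ·_) (φ-++ u v) ⟩
  φL x · (φ u · φ v)     ≡⟨ ·-assoc (φL x) (φ u) (φ v) ⟨
  (φL x · φ u) · φ v     ≡⟨ cong (_· φ v) (φ-∷ x u) ⟨
  φ (x ∷ u) · φ v        ∎
  where open ≡-Reasoning

φ-∷ʳ : ∀ w x → φ (w ++ x ∷ []) ≡ φ w · φL x
φ-∷ʳ w x = trans (φ-++ w (x ∷ [])) (cong (φ w ·_) φ-[ x ])

run-∷ʳ : ∀ (A : DFA) q w x → run A q (w ++ x ∷ []) ≡ DFA.δ A (run A q w) x
run-∷ʳ A q []      x = refl
run-∷ʳ A q (y ∷ w) x = run-∷ʳ A (DFA.δ A q y) w x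

Unit : ℤ → Set
Unit u = u ≡ 1ℤ ⊎ u ≡ - 1ℤ

Unit-* : ∀ {u v} → Unit u → Unit v → Unit (u * v)
Unit-* (inj₁ refl) (inj₁ refl) = inj₁ refl
Unit-* (inj₁ refl) (inj₂ refl) = inj₂ refl
Unit-* (inj₂ refl) (inj₁ refl) = inj₂ refl
Unit-* (inj₂ refl) (inj₂ refl) = inj₁ refl

Unit-∣∣ : ∀ {u} → Unit u → ∣ u ∣ ≡ 1
Unit-∣∣ (inj₁ refl) = refl
Unit-∣∣ (inj₂ refl) = refl

Unit-det-φL : ∀ x → Unit (det (φL x))
Unit-det-φL X = inj₁ refl
Unit-det-φL N = inj₂ refl
Unit-det-φL S = inj₁ refl
Unit-det-φL R = inj₁ refl

Unit-det-φ : ∀ w → Unit (det (φ w))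
Unit-det-φ []      = inj₁ refl
Unit-det-φ (x ∷ w) = subst Unit (sym (det-⊗ (φL x) (φ w))) (Unit-* (Unit-det-φL x) (Unit-det-φ w))

Unit-inverse : ∀ {u} → Unit u → ∀ x y → u * x ≡ y → x ≡ u * y
Unit-inverse (inj₁ refl) x y ux≡y = trans (sym (*-identityˡ x)) (trans ux≡y (sym (*-identityˡ y)))
Unit-inverse (inj₂ refl) x y ux≡y = trans (sym (neg-neg x)) (cong (- 1ℤ *_) ux≡y)
  where
  neg-neg : ∀ x → - 1ℤ * (- 1ℤ * x) ≡ x
  neg-neg = solve-∀

-- Reduction to diag(1, n)

diag₁ : ℤ → Mat2
diag₁ n = mat 1ℤ 0ℤ 0ℤ n

scale : ℤ → Mat2 → Mat2
scale m (mat a b c d) = mat (m * a) (m * b) (m * c) (m * d)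

scale-injective : ∀ {m} → m ≢ 0ℤ → ∀ A B → scale m A ≡ scale m B → A ≡ B
scale-injective {m} m≢0 (mat a b c d) (mat a' b' c' d') eq =
  mat-cong (cancel (cong Mat2.a eq)) (cancel (cong Mat2.b eq)) (cancel (cong Mat2.c eq)) (cancel (cong Mat2.d eq))
  where
  cancel : ∀ {x y} → m * x ≡ m * y → x ≡ y
  cancel {x} {y} = *-cancelˡ-≡ m x y {{≢-nonZero m≢0}}

diagSNF≡scale : ∀ m n → diagSNF m n ≡ scale m (diag₁ n)
diagSNF≡scale m n = mat-cong (one m) (null m) (null m) refl
  where
  one : ∀ m → m ≡ m * 1ℤ
  one = solve-∀
  null : ∀ m → 0ℤ ≡ m * 0ℤ
  null = solve-∀

⊗-diagSNF-⊗ : ∀ m n A B → A ⊗ diagSNF m n ⊗ B ≡ scale m (A · diag₁ n · B)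
⊗-diagSNF-⊗ m n (mat a₁ a₂ a₃ a₄) (mat b₁ b₂ b₃ b₄) = begin
  mat a₁ a₂ a₃ a₄ ⊗ diagSNF m n ⊗ mat b₁ b₂ b₃ b₄
    ≡⟨ mat-cong (entry m n a₁ a₂ b₁ b₃) (entry m n a₁ a₂ b₂ b₄) (entry m n a₃ a₄ b₁ b₃) (entry m n a₃ a₄ b₂ b₄) ⟩
  scale m (mat a₁ a₂ a₃ a₄ ⊗ diag₁ n ⊗ mat b₁ b₂ b₃ b₄)
    ≡⟨ cong (λ P → scale m (P ⊗ mat b₁ b₂ b₃ b₄)) (·≡⊗ _ _) ⟨
  scale m (mat a₁ a₂ a₃ a₄ · diag₁ n ⊗ mat b₁ b₂ b₃ b₄)
    ≡⟨ cong (scale m) (·≡⊗ _ _) ⟨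
  scale m (mat a₁ a₂ a₃ a₄ · diag₁ n · mat b₁ b₂ b₃ b₄) ∎
  where
  open ≡-Reasoning
  entry : ∀ m n a₁ a₂ b₁ b₃ → (a₁ * m + a₂ * 0ℤ) * b₁ + (a₁ * 0ℤ + a₂ * (m * n)) * b₃
                               ≡ m * ((a₁ * 1ℤ + a₂ * 0ℤ) * b₁ + (a₁ * 0ℤ + a₂ * n) * b₃)
  entry = solve-∀

diagSNF-equation⇔ : ∀ {m} n → m ≢ 0ℤ → ∀ A B →
  (A ⊗ diagSNF m n ⊗ B ≡ diagSNF m n) ⇔ (A · diag₁ n · B ≡ diag₁ n)
diagSNF-equation⇔ {m} n m≢0 A B = mk⇔
  (λ eq → scale-injective m≢0 _ _ (trans (sym (⊗-diagSNF-⊗ m n A B)) (trans eq (diagSNF≡scale m n))))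
  (λ eq → trans (⊗-diagSNF-⊗ m n A B) (trans (cong (scale m) eq) (sym (diagSNF≡scale m n))))

·-cancelʳ-diag₁ : ∀ {n} → n ≢ 0ℤ → ∀ A B → A · diag₁ n ≡ B · diag₁ n → A ≡ B
·-cancelʳ-diag₁ {n} n≢0 (mat a₁ a₂ a₃ a₄) (mat b₁ b₂ b₃ b₄) eq′ =
  mat-cong (first a₁ a₂ b₁ b₂ (cong Mat2.a eq)) (second a₁ a₂ b₁ b₂ (cong Mat2.b eq))
           (first a₃ a₄ b₃ b₄ (cong Mat2.c eq)) (second a₃ a₄ b₃ b₄ (cong Mat2.d eq))
  where
  eq : mat a₁ a₂ a₃ a₄ ⊗ diag₁ n ≡ mat b₁ b₂ b₃ b₄ ⊗ diag₁ n
  eq = trans (sym (·≡⊗ _ _)) (trans eq′ (·≡⊗ _ _))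
  column₁ : ∀ x y → x * 1ℤ + y * 0ℤ ≡ x
  column₁ = solve-∀
  column₂ : ∀ x y n → x * 0ℤ + y * n ≡ y * n
  column₂ = solve-∀
  first : ∀ x y x' y' → x * 1ℤ + y * 0ℤ ≡ x' * 1ℤ + y' * 0ℤ → x ≡ x'
  first x y x' y' e = trans (sym (column₁ x y)) (trans e (column₁ x' y'))
  second : ∀ x y x' y' → x * 0ℤ + y * n ≡ x' * 0ℤ + y' * n → y ≡ y'
  second x y x' y' e = *-cancelʳ-≡ y y' n {{≢-nonZero n≢0}} (trans (sym (column₂ x y n)) (trans e (column₂ x' y' n)))

φN·diag₁ : ∀ n → φL N · diag₁ n ≡ diag₁ (- n)
φN·diag₁ n = trans (·≡⊗ (φL N) (diag₁ n)) (mat-cong refl refl refl (entry n))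
  where
  entry : ∀ n → 0ℤ * 0ℤ + - 1ℤ * n ≡ - n
  entry = solve-∀

-- Hermite normal form

upper : ℕ → ℤ → ℤ → Mat2
upper a b d = mat (+ a) b 0ℤ d

Reduced : ℤ → ℤ → Set
Reduced b d = d ≢ 0ℤ → Σ ℕ λ r → b ≡ + r × r < ∣ d ∣

Reduced-multiple≡0 : ∀ {b d} k → d ≢ 0ℤ → Reduced b d → b ≡ k * d → b ≡ 0ℤ
Reduced-multiple≡0 {b} {d} k d≢0 reduced b≡kd with reduced d≢0
... | r , b≡r , r<∣d∣ = trans b≡kd (cong (_* d) k≡0)
  where
  ∣k∣*∣d∣<1*∣d∣ : ∣ k ∣ ℕ.* ∣ d ∣ < 1 ℕ.* ∣ d ∣
  ∣k∣*∣d∣<1*∣d∣ = subst₂ _<_ (trans (cong ∣_∣ (trans (sym b≡r) b≡kd)) (abs-* k d)) (sym (ℕ.*-identityˡ ∣ d ∣)) r<∣d∣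
  k≡0 : k ≡ 0ℤ
  k≡0 = ∣i∣≡0⇒i≡0 (ℕ.n<1⇒n≡0 (ℕ.*-cancelʳ-< (∣ d ∣) (∣ k ∣) 1 ∣k∣*∣d∣<1*∣d∣))

·-upper : ∀ g₁ g₂ g₃ g₄ a b d →
  mat g₁ g₂ g₃ g₄ · upper a b d ≡ mat (g₁ * + a) (g₁ * b + g₂ * d) (g₃ * + a) (g₃ * b + g₄ * d)
·-upper g₁ g₂ g₃ g₄ a b d = trans (·≡⊗ _ _) (mat-cong (entry g₁ g₂ (+ a)) refl (entry g₃ g₄ (+ a)) refl)
  where
  entry : ∀ x y a → x * a + y * 0ℤ ≡ x * a
  entry = solve-∀

x*+a≡1⇒ : ∀ x a → x * + a ≡ 1ℤ → a ≡ 1 × x ≡ 1ℤ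
x*+a≡1⇒ x a eq with ℕ.m*n≡1⇒n≡1 ∣ x ∣ a (trans (sym (abs-* x (+ a))) (cong ∣_∣ eq))
... | refl = refl , trans (sym (*-identityʳ x)) eq

unimodular-upper≡diag₁ : ∀ {n} → n ≢ 0ℤ → ∀ G a b d → Unit (det G) → Reduced b d →
  G · upper a b d ≡ diag₁ n → upper a b d ≡ diag₁ n ⊎ upper a b d ≡ diag₁ (- n)
unimodular-upper≡diag₁ {n} n≢0 (mat g₁ g₂ g₃ g₄) a b d unit reduced eq′
  with eq ← trans (sym (·-upper g₁ g₂ g₃ g₄ a b d)) eq′
  with x*+a≡1⇒ g₁ a (cong Mat2.a eq)
... | refl , refl with trans (sym (*-identityʳ g₃)) (cong Mat2.c eq)
... | refl = result (subst Unit (det-unitriangular g₂ g₄) unit)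
  where
  det-unitriangular : ∀ g₂ g₄ → 1ℤ * g₄ + - (g₂ * 0ℤ) ≡ g₄
  det-unitriangular = solve-∀
  b+g₂d≡0 : b + g₂ * d ≡ 0ℤ
  b+g₂d≡0 = trans (sym (cong (_+ g₂ * d) (*-identityˡ b))) (cong Mat2.b eq)
  g₄d≡n : g₄ * d ≡ n
  g₄d≡n = trans (sym (trans (cong (_+ g₄ * d) (*-zeroˡ b)) (+-identityˡ (g₄ * d)))) (cong Mat2.d eq)
  d≢0 : d ≢ 0ℤ
  d≢0 refl = n≢0 (trans (sym g₄d≡n) (*-zeroʳ g₄))
  b≡0 : b ≡ 0ℤ
  b≡0 = Reduced-multiple≡0 (- g₂) d≢0 reduced (trans (solve b g₂ d) (trans (cong (_+ (- g₂) * d) b+g₂d≡0) (+-identityˡ _)))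
    where
    solve : ∀ b g d → b ≡ (b + g * d) + (- g) * d
    solve = solve-∀
  result : Unit g₄ → mat (+ 1) b 0ℤ d ≡ diag₁ n ⊎ mat (+ 1) b 0ℤ d ≡ diag₁ (- n)
  result (inj₁ refl) = inj₁ (mat-cong refl b≡0 refl (trans (sym (*-identityˡ d)) g₄d≡n))
  result (inj₂ refl) = inj₂ (mat-cong refl b≡0 refl (trans (sym (neg-neg d)) (cong -_ g₄d≡n)))
    where
    neg-neg : ∀ d → - (- 1ℤ * d) ≡ d
    neg-neg = solve-∀

upper-bounds : ∀ {n u} a b d → n ≢ 0ℤ → Unit u → det (upper a b d) ≡ u * n →
  a ≤ ∣ n ∣ × ∣ d ∣ ≤ ∣ n ∣ × d ≢ 0ℤ
upper-bounds {n} {u} a b d n≢0 unit det≡un =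
  ∣⇒≤ {{≢-nonZero n≢0}} (divides ∣ d ∣ (trans (sym a∣d∣≡∣n∣) (ℕ.*-comm a ∣ d ∣))) ,
  ∣⇒≤ {{≢-nonZero n≢0}} (divides a (sym a∣d∣≡∣n∣)) ,
  d≢0
  where
  det-upper : ∀ a b d → a * d + - (b * 0ℤ) ≡ a * d
  det-upper = solve-∀
  a∣d∣≡∣n∣ : a ℕ.* ∣ d ∣ ≡ ∣ n ∣
  a∣d∣≡∣n∣ = begin
    a ℕ.* ∣ d ∣          ≡⟨ abs-* (+ a) d ⟨
    ∣ + a * d ∣          ≡⟨ cong ∣_∣ (trans (sym (det-upper (+ a) b d)) det≡un) ⟩
    ∣ u * n ∣            ≡⟨ abs-* u n ⟩
    ∣ u ∣ ℕ.* ∣ n ∣      ≡⟨ cong (ℕ._* ∣ n ∣) (Unit-∣∣ unit) ⟩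
    1 ℕ.* ∣ n ∣          ≡⟨ ℕ.*-identityˡ ∣ n ∣ ⟩
    ∣ n ∣                ∎
    where open ≡-Reasoning
  d≢0 : d ≢ 0ℤ
  d≢0 refl = n≢0 (∣i∣≡0⇒i≡0 (trans (sym a∣d∣≡∣n∣) (ℕ.*-zeroʳ a)))

translation : ℤ → Mat2
translation k = mat 1ℤ k 0ℤ 1ℤ

translation-+ : ∀ k l → translation k ⊗ translation l ≡ translation (k + l)
translation-+ k l = mat-cong (e₁₁ k l) (e₁₂ k l) (e₂₁ k l) (e₂₂ k l)
  where
  e₁₁ : ∀ k l → 1ℤ * 1ℤ + k * 0ℤ ≡ 1ℤ
  e₁₁ = solve-∀
  e₁₂ : ∀ k l → 1ℤ * l + k * 1ℤ ≡ k + l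
  e₁₂ = solve-∀
  e₂₁ : ∀ k l → 0ℤ * 1ℤ + 1ℤ * 0ℤ ≡ 0ℤ
  e₂₁ = solve-∀
  e₂₂ : ∀ k l → 0ℤ * l + 1ℤ * 1ℤ ≡ 1ℤ
  e₂₂ = solve-∀

-- φ (X S R) = translation 1 and φ (X R R S) = translation -1
translationWord : ℤ → List Letter
translationWord (+ n)    = concat (replicate n (X ∷ S ∷ R ∷ []))
translationWord -[1+ n ] = concat (replicate (suc n) (X ∷ R ∷ R ∷ S ∷ []))

φ-concat-replicate : ∀ n w k → φ w ≡ translation k → φ (concat (replicate n w)) ≡ translation (+ n * k)
φ-concat-replicate zero    w k _   = cong translation (sym (*-zeroˡ k))
φ-concat-replicate (suc n) w k φw≡ = begin
  φ (w ++ concat (replicate n w))                ≡⟨ φ-++ w _ ⟩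
  φ w · φ (concat (replicate n w))               ≡⟨ cong₂ _·_ φw≡ (φ-concat-replicate n w k φw≡) ⟩
  translation k · translation (+ n * k)          ≡⟨ ·≡⊗ _ _ ⟩
  translation k ⊗ translation (+ n * k)          ≡⟨ translation-+ k (+ n * k) ⟩
  translation (k + + n * k)                      ≡⟨ cong translation (distrib (+ n) k) ⟩
  translation (+ suc n * k)                      ∎
  where
  open ≡-Reasoning
  distrib : ∀ m k → k + m * k ≡ (1ℤ + m) * k
  distrib = solve-∀

φ-translationWord : ∀ k → φ (translationWord k) ≡ translation k
φ-translationWord (+ n)    = trans (φ-concat-replicate n (X ∷ S ∷ R ∷ []) 1ℤ refl) (cong translation (*-identityʳ (+ n)))
φ-translationWord -[1+ n ] = trans (φ-concat-replicate (suc n) (X ∷ R ∷ R ∷ S ∷ []) (- 1ℤ) refl) (cong translation (neg (+ suc n)))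
  where
  neg : ∀ x → x * - 1ℤ ≡ - x
  neg = solve-∀

record HermiteDecomposition (Q : Mat2) : Set where
  constructor hermite
  field
    word          : List Letter
    a             : ℕ
    b d           : ℤ
    factorisation : Q ≡ φ word · upper a b d
    reduced       : Reduced b d

prepend : ∀ {Q Q'} w → Q ≡ φ w · Q' → HermiteDecomposition Q' → HermiteDecomposition Q
prepend {Q} {Q'} w Q≡ (hermite w' a b d Q'≡ reduced) = hermite (w ++ w') a b d Q≡′ reduced
  where
  open ≡-Reasoning
  Q≡′ : Q ≡ φ (w ++ w') · upper a b d
  Q≡′ = begin
    Q                             ≡⟨ Q≡ ⟩
    φ w · Q'                      ≡⟨ cong (φ w ·_) Q'≡ ⟩
    φ w · (φ w' · upper a b d)    ≡⟨ ·-assoc (φ w) (φ w') _ ⟨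
    φ w · φ w' · upper a b d      ≡⟨ cong (_· upper a b d) (φ-++ w w') ⟨
    φ (w ++ w') · upper a b d     ∎

divMod : ∀ a d → d ≢ 0ℤ → Σ ℤ λ k → Σ ℕ λ r → a ≡ + r + k * d × r < ∣ d ∣
divMod a d d≢0 = let instance _ = ≢-nonZero d≢0 in a / d , a % d , a≡a%n+[a/n]*n a d , n%d<d a d

hermite-upper : ∀ a b d → HermiteDecomposition (upper a b d)
hermite-upper a b d with d ≟ℤ 0ℤ
... | yes refl = hermite [] a b 0ℤ (sym (·-identityˡ _)) (λ 0≢0 → ⊥-elim (0≢0 refl))
... | no d≢0 with divMod b d d≢0
... | k , r , b≡r+kd , r<∣d∣ =
  prepend (translationWord k) upper≡ (hermite [] a (+ r) d (sym (·-identityˡ _)) (λ _ → r , refl , r<∣d∣))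
  where
  shear : ∀ a r k d → upper a (r + k * d) d ≡ translation k ⊗ upper a r d
  shear a r k d = mat-cong (e₁₁ (+ a) k) (e₁₂ r k d) (e₂₁ (+ a)) (e₂₂ r d)
    where
    e₁₁ : ∀ a k → a ≡ 1ℤ * a + k * 0ℤ
    e₁₁ = solve-∀
    e₁₂ : ∀ r k d → r + k * d ≡ 1ℤ * r + k * d
    e₁₂ = solve-∀
    e₂₁ : ∀ a → 0ℤ ≡ 0ℤ * a + 1ℤ * 0ℤ
    e₂₁ = solve-∀
    e₂₂ : ∀ r d → d ≡ 0ℤ * r + 1ℤ * d
    e₂₂ = solve-∀
  upper≡ : upper a b d ≡ φ (translationWord k) · upper a (+ r) d
  upper≡ = trans (cong (λ b → upper a b d) b≡r+kd)
             (trans (shear a (+ r) k d)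
               (trans (cong (_⊗ upper a (+ r) d) (sym (φ-translationWord k))) (sym (·≡⊗ _ _))))

hermite-triangular : ∀ a b d → HermiteDecomposition (mat a b 0ℤ d)
hermite-triangular (+ a)    b d = hermite-upper a b d
hermite-triangular -[1+ a ] b d = prepend (X ∷ []) negate (hermite-upper (suc a) (- b) (- d))
  where
  e₁₁ : ∀ x → - x ≡ - 1ℤ * x + 0ℤ * 0ℤ
  e₁₁ = solve-∀
  e₁₂ : ∀ b d → b ≡ - 1ℤ * - b + 0ℤ * - d
  e₁₂ = solve-∀
  e₂₁ : ∀ x → 0ℤ ≡ 0ℤ * x + - 1ℤ * 0ℤ
  e₂₁ = solve-∀
  e₂₂ : ∀ b d → d ≡ 0ℤ * - b + - 1ℤ * - d
  e₂₂ = solve-∀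
  negate : mat -[1+ a ] b 0ℤ d ≡ φ (X ∷ []) · upper (suc a) (- b) (- d)
  negate = trans (mat-cong (e₁₁ (+ suc a)) (e₁₂ b d) (e₂₁ (+ suc a)) (e₂₂ b d))
                 (sym (trans (cong (_· upper (suc a) (- b) (- d)) φ-[ X ]) (·≡⊗ _ _)))

-- T^k S turns the first column (r + k c, c) into (c, -r).
euclid-step : ∀ a b c d r k → a ≡ r + k * c →
  mat a b c d ≡ φ (translationWord k ++ S ∷ []) · mat c d (- r) (- (b - k * d))
euclid-step a b c d r k a≡r+kc = begin
  mat a b c d                                            ≡⟨ mat-cong (trans a≡r+kc (e₁₁ r k c)) (e₁₂ b k d) (e₂₁ c r) (e₂₂ b k d) ⟩
  translation k ⊗ (φL S ⊗ M)                             ≡⟨ cong (translation k ⊗_) (·≡⊗ (φL S) M) ⟨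
  translation k ⊗ (φL S · M)                             ≡⟨ ·≡⊗ _ _ ⟨
  translation k · (φL S · M)                             ≡⟨ ·-assoc _ _ _ ⟨
  translation k · φL S · M                               ≡⟨ cong (λ T → T · φL S · M) (φ-translationWord k) ⟨
  φ (translationWord k) · φL S · M                       ≡⟨ cong (_· M) (φ-∷ʳ (translationWord k) S) ⟨
  φ (translationWord k ++ S ∷ []) · M                    ∎
  where
  open ≡-Reasoning
  M = mat c d (- r) (- (b - k * d))
  e₁₁ : ∀ r k c → r + k * c ≡ 1ℤ * (0ℤ * c + - 1ℤ * - r) + k * (1ℤ * c + 0ℤ * - r)
  e₁₁ = solve-∀
  e₁₂ : ∀ b k d → b ≡ 1ℤ * (0ℤ * d + - 1ℤ * - (b - k * d)) + k * (1ℤ * d + 0ℤ * - (b - k * d))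
  e₁₂ = solve-∀
  e₂₁ : ∀ c r → c ≡ 0ℤ * (0ℤ * c + - 1ℤ * - r) + 1ℤ * (1ℤ * c + 0ℤ * - r)
  e₂₁ = solve-∀
  e₂₂ : ∀ b k d → d ≡ 0ℤ * (0ℤ * d + - 1ℤ * - (b - k * d)) + 1ℤ * (1ℤ * d + 0ℤ * - (b - k * d))
  e₂₂ = solve-∀

hermite-< : ∀ {bound} Q → ∣ Mat2.c Q ∣ < bound → HermiteDecomposition Q
hermite-< {zero}      _             ()
hermite-< {suc bound} (mat a b c d) (ℕ.s≤s ∣c∣≤bound) with c ≟ℤ 0ℤ
... | yes refl = hermite-triangular a b d
... | no c≢0 with divMod a c c≢0
... | k , r , a≡r+kc , r<∣c∣ =
  prepend (translationWord k ++ S ∷ []) (euclid-step a b c d (+ r) k a≡r+kc)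
    (hermite-< (mat c d (- + r) (- (b - k * d))) (subst (_< bound) (sym (∣-i∣≡∣i∣ (+ r))) (ℕ.<-≤-trans r<∣c∣ ∣c∣≤bound)))

opaque
  hermiteDecomposition : ∀ Q → HermiteDecomposition Q
  hermiteDecomposition Q = hermite-< Q (ℕ.n<1+n ∣ Mat2.c Q ∣)

-- The amalgam structure of GL(2,ℤ)

-- GL(2,ℤ) is the free product of its finite subgroups of orders 8 and 12 amalgamated
-- over their common subgroup of order 4. Elt enumerates the union of the two factors:
-- the common part, the rest of the order-8 factor (symmetries of a square) and the
-- rest of the order-12 factor (symmetries of a hexagon).
Elt : Set
Elt = Fin 16

pattern γ₀  = zero
pattern γ₁  = suc γ₀
pattern γ₂  = suc γ₁
pattern γ₃  = suc γ₂
pattern γ₄  = suc γ₃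
pattern γ₅  = suc γ₄
pattern γ₆  = suc γ₅
pattern γ₇  = suc γ₆
pattern γ₈  = suc γ₇
pattern γ₉  = suc γ₈
pattern γ₁₀ = suc γ₉
pattern γ₁₁ = suc γ₁₀
pattern γ₁₂ = suc γ₁₁
pattern γ₁₃ = suc γ₁₂
pattern γ₁₄ = suc γ₁₃
pattern γ₁₅ = suc γ₁₄

⟦_⟧ : Elt → Mat2
⟦ γ₀  ⟧ = mat 1ℤ 0ℤ 0ℤ 1ℤ
⟦ γ₁  ⟧ = mat (- 1ℤ) 0ℤ 0ℤ (- 1ℤ)
⟦ γ₂  ⟧ = mat 0ℤ (- 1ℤ) (- 1ℤ) 0ℤ
⟦ γ₃  ⟧ = mat 0ℤ 1ℤ 1ℤ 0ℤ
⟦ γ₄  ⟧ = mat 0ℤ (- 1ℤ) 1ℤ 0ℤ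
⟦ γ₅  ⟧ = mat 0ℤ 1ℤ (- 1ℤ) 0ℤ
⟦ γ₆  ⟧ = mat 1ℤ 0ℤ 0ℤ (- 1ℤ)
⟦ γ₇  ⟧ = mat (- 1ℤ) 0ℤ 0ℤ 1ℤ
⟦ γ₈  ⟧ = mat 0ℤ (- 1ℤ) 1ℤ 1ℤ
⟦ γ₉  ⟧ = mat 0ℤ 1ℤ (- 1ℤ) (- 1ℤ)
⟦ γ₁₀ ⟧ = mat (- 1ℤ) (- 1ℤ) 1ℤ 0ℤ
⟦ γ₁₁ ⟧ = mat 1ℤ 1ℤ (- 1ℤ) 0ℤ
⟦ γ₁₂ ⟧ = mat 1ℤ 0ℤ (- 1ℤ) (- 1ℤ)
⟦ γ₁₃ ⟧ = mat (- 1ℤ) 0ℤ 1ℤ 1ℤ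
⟦ γ₁₄ ⟧ = mat (- 1ℤ) (- 1ℤ) 0ℤ 1ℤ
⟦ γ₁₅ ⟧ = mat 1ℤ 1ℤ 0ℤ (- 1ℤ)

data Part : Set where
  common square hexagon : Part

part : Elt → Part
part γ₀ = common
part γ₁ = common
part γ₂ = common
part γ₃ = common
part γ₄ = square
part γ₅ = square
part γ₆ = square
part γ₇ = square
part _  = hexagon

_≟ᵖ_ : DecidableEquality Part
common  ≟ᵖ common  = yes refl
square  ≟ᵖ square  = yes refl
hexagon ≟ᵖ hexagon = yes refl
common  ≟ᵖ square  = no λ ()
common  ≟ᵖ hexagon = no λ ()
square  ≟ᵖ common  = no λ ()
square  ≟ᵖ hexagon = no λ ()
hexagon ≟ᵖ common  = no λ ()
hexagon ≟ᵖ square  = no λ ()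

letterElt : Letter → Elt
letterElt X = γ₁
letterElt N = γ₆
letterElt S = γ₄
letterElt R = γ₈

⟦letterElt⟧ : ∀ x → ⟦ letterElt x ⟧ ≡ φL x
⟦letterElt⟧ X = refl
⟦letterElt⟧ N = refl
⟦letterElt⟧ S = refl
⟦letterElt⟧ R = refl

sameFactor : Part → Part → Bool
sameFactor common _       = true
sameFactor _      common  = true
sameFactor square square  = true
sameFactor hexagon hexagon = true
sameFactor _      _       = false

alternates : Part → Part → Bool
alternates square  hexagon = true
alternates hexagon square  = true
alternates _       _       = false

SameFactor : Elt → Elt → Set
SameFactor e e' = T (sameFactor (part e) (part e'))

Alternate : Elt → Elt → Set
Alternate e e' = T (alternates (part e) (part e'))

sameFactor-or-alternate : ∀ e e' → SameFactor e e' ⊎ Alternate e e'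
sameFactor-or-alternate e e' = by-parts (part e) (part e')
  where
  by-parts : ∀ p p' → T (sameFactor p p') ⊎ T (alternates p p')
  by-parts common  _       = inj₁ tt
  by-parts square  common  = inj₁ tt
  by-parts hexagon common  = inj₁ tt
  by-parts square  square  = inj₁ tt
  by-parts hexagon hexagon = inj₁ tt
  by-parts square  hexagon = inj₂ tt
  by-parts hexagon square  = inj₂ tt

SameFactor-γ₀ : ∀ e → SameFactor e γ₀
SameFactor-γ₀ e with part e
... | common  = tt
... | square  = tt
... | hexagon = tt

common⇒¬hexagon : ∀ {e} → part e ≡ common → part e ≢ hexagon
common⇒¬hexagon e-common e-hexagon with trans (sym e-common) e-hexagon
... | ()

square⇒¬hexagon : ∀ {e} → part e ≡ square → part e ≢ hexagon
square⇒¬hexagon e-square e-hexagon with trans (sym e-square) e-hexagon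
... | ()

Alternate⇒parts : ∀ {e e'} → Alternate e e' → part e ≡ square × part e' ≡ hexagon ⊎ part e ≡ hexagon × part e' ≡ square
Alternate⇒parts {e} {e'} alternate with part e | part e'
... | square  | hexagon = inj₁ (refl , refl)
... | hexagon | square  = inj₂ (refl , refl)

Alternate-square : ∀ {e e'} → Alternate e e' → part e ≡ square → part e' ≡ hexagon
Alternate-square alternate e-square with Alternate⇒parts alternate
... | inj₁ (_ , e'-hexagon) = e'-hexagon
... | inj₂ (e-hexagon , _)  = ⊥-elim (square⇒¬hexagon e-square e-hexagon)

Alternate-hexagon : ∀ {e e'} → Alternate e e' → part e ≡ hexagon → part e' ≡ square
Alternate-hexagon alternate e-hexagon with Alternate⇒parts alternate
... | inj₁ (e-square , _)  = ⊥-elim (square⇒¬hexagon e-square e-hexagon)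
... | inj₂ (_ , e'-square) = e'-square

shear : Bool → Mat2
shear true  = mat 1ℤ 1ℤ 0ℤ 1ℤ
shear false = mat 1ℤ 0ℤ 1ℤ 1ℤ

absSum : Mat2 → ℕ
absSum (mat a b c d) = ∣ a ∣ ℕ.+ ∣ b ∣ ℕ.+ ∣ c ∣ ℕ.+ ∣ d ∣

opaque
  unfolding _·_

  ·-closed : ∀ e₁ e₂ → SameFactor e₁ e₂ → ∃ λ e → ⟦ e ⟧ ≡ ⟦ e₁ ⟧ · ⟦ e₂ ⟧
  ·-closed = toWitness {a? = Fin.all? λ e₁ → Fin.all? λ e₂ → T? (sameFactor (part e₁) (part e₂)) →-dec
                                Fin.any? λ e → ⟦ e ⟧ ≟ₘ ⟦ e₁ ⟧ · ⟦ e₂ ⟧} tt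

  alternating₂-∉ : ∀ e₁ e₂ → Alternate e₁ e₂ → ∀ e → ⟦ e₁ ⟧ · (⟦ e₂ ⟧ · I₂) ≢ ⟦ e ⟧
  alternating₂-∉ = toWitness {a? = Fin.all? λ e₁ → Fin.all? λ e₂ → T? (alternates (part e₁) (part e₂)) →-dec
                                       Fin.all? λ e → ¬? (⟦ e₁ ⟧ · (⟦ e₂ ⟧ · I₂) ≟ₘ ⟦ e ⟧)} tt

  square-hexagon-square-∉ : ∀ e₁ e₂ e₃ → part e₁ ≡ square → part e₂ ≡ hexagon → part e₃ ≡ square →
    ∀ e → ⟦ e₁ ⟧ · (⟦ e₂ ⟧ · (⟦ e₃ ⟧ · I₂)) ≢ ⟦ e ⟧
  square-hexagon-square-∉ = toWitness {a? = Fin.all? λ e₁ → Fin.all? λ e₂ → Fin.all? λ e₃ →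
    (part e₁ ≟ᵖ square) →-dec ((part e₂ ≟ᵖ hexagon) →-dec ((part e₃ ≟ᵖ square) →-dec
    Fin.all? λ e → ¬? (⟦ e₁ ⟧ · (⟦ e₂ ⟧ · (⟦ e₃ ⟧ · I₂)) ≟ₘ ⟦ e ⟧)))} tt

  square·hexagon≡shear·common : ∀ a b → part a ≡ square → part b ≡ hexagon →
    Σ Bool λ t → Σ Elt λ c → part c ≡ common × ⟦ a ⟧ · ⟦ b ⟧ ≡ shear t · ⟦ c ⟧
  square·hexagon≡shear·common = toWitness {a? = Fin.all? λ a → Fin.all? λ b →
    (part a ≟ᵖ square) →-dec ((part b ≟ᵖ hexagon) →-dec bool? λ t → Fin.any? λ c →
    (part c ≟ᵖ common) ×-dec (⟦ a ⟧ · ⟦ b ⟧ ≟ₘ shear t · ⟦ c ⟧))} tt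
    where
    bool? : ∀ {P : Bool → Set} → (∀ b → Dec (P b)) → Dec (Σ Bool P)
    bool? P? with P? true | P? false
    ... | yes p | _     = yes (true , p)
    ... | no _  | yes p = yes (false , p)
    ... | no ¬p | no ¬q = no λ { (true , p) → ¬p p ; (false , q) → ¬q q }

  common·square∈square : ∀ c a → part c ≡ common → part a ≡ square →
    Σ Elt λ a' → part a' ≡ square × ⟦ c ⟧ · ⟦ a ⟧ ≡ ⟦ a' ⟧
  common·square∈square = toWitness {a? = Fin.all? λ c → Fin.all? λ a →
    (part c ≟ᵖ common) →-dec ((part a ≟ᵖ square) →-dec Fin.any? λ a' →
    (part a' ≟ᵖ square) ×-dec (⟦ c ⟧ · ⟦ a ⟧ ≟ₘ ⟦ a' ⟧))} tt

  hexagon≡common·R∨R² : ∀ e → part e ≡ hexagon →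
    Σ Elt λ c → part c ≡ common × (⟦ e ⟧ ≡ ⟦ c ⟧ · φL R ⊎ ⟦ e ⟧ ≡ ⟦ c ⟧ · (φL R · φL R))
  hexagon≡common·R∨R² = toWitness {a? = Fin.all? λ e → (part e ≟ᵖ hexagon) →-dec Fin.any? λ c →
    (part c ≟ᵖ common) ×-dec ((⟦ e ⟧ ≟ₘ ⟦ c ⟧ · φL R) ⊎-dec (⟦ e ⟧ ≟ₘ ⟦ c ⟧ · (φL R · φL R)))} tt

  absSum-⟦⟧≤3 : ∀ e → absSum ⟦ e ⟧ ≤ 3
  absSum-⟦⟧≤3 = toWitness {a? = Fin.all? λ e → absSum ⟦ e ⟧ ℕ.≤? 3} tt

-- Ping-pong

data SignedPermutation : Mat2 → Set where
  diagonal     : ∀ {u v} → Unit u → Unit v → SignedPermutation (mat u 0ℤ 0ℤ v)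
  antidiagonal : ∀ {u v} → Unit u → Unit v → SignedPermutation (mat 0ℤ u v 0ℤ)

signedPermutation : ∀ e → part e ≢ hexagon → SignedPermutation ⟦ e ⟧
signedPermutation γ₀  _ = diagonal     (inj₁ refl) (inj₁ refl)
signedPermutation γ₁  _ = diagonal     (inj₂ refl) (inj₂ refl)
signedPermutation γ₂  _ = antidiagonal (inj₂ refl) (inj₂ refl)
signedPermutation γ₃  _ = antidiagonal (inj₁ refl) (inj₁ refl)
signedPermutation γ₄  _ = antidiagonal (inj₂ refl) (inj₁ refl)
signedPermutation γ₅  _ = antidiagonal (inj₁ refl) (inj₂ refl)
signedPermutation γ₆  _ = diagonal     (inj₁ refl) (inj₂ refl)
signedPermutation γ₇  _ = diagonal     (inj₂ refl) (inj₁ refl)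
signedPermutation γ₈  ¬hexagon = ⊥-elim (¬hexagon refl)
signedPermutation γ₉  ¬hexagon = ⊥-elim (¬hexagon refl)
signedPermutation γ₁₀ ¬hexagon = ⊥-elim (¬hexagon refl)
signedPermutation γ₁₁ ¬hexagon = ⊥-elim (¬hexagon refl)
signedPermutation γ₁₂ ¬hexagon = ⊥-elim (¬hexagon refl)
signedPermutation γ₁₃ ¬hexagon = ⊥-elim (¬hexagon refl)
signedPermutation γ₁₄ ¬hexagon = ⊥-elim (¬hexagon refl)
signedPermutation γ₁₅ ¬hexagon = ⊥-elim (¬hexagon refl)

∣*Unit∣ : ∀ x {u} → Unit u → ∣ x * u ∣ ≡ ∣ x ∣
∣*Unit∣ x {u} unit = trans (abs-* x u) (trans (cong (∣ x ∣ ℕ.*_) (Unit-∣∣ unit)) (ℕ.*-identityʳ ∣ x ∣))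

∣Unit*∣ : ∀ {u} x → Unit u → ∣ u * x ∣ ≡ ∣ x ∣
∣Unit*∣ {u} x unit = trans (abs-* u x) (trans (cong (ℕ._* ∣ x ∣) (Unit-∣∣ unit)) (ℕ.*-identityˡ ∣ x ∣))

+-cong₄ : ∀ {a b c d a' b' c' d' : ℕ} → a ≡ a' → b ≡ b' → c ≡ c' → d ≡ d' →
  a ℕ.+ b ℕ.+ c ℕ.+ d ≡ a' ℕ.+ b' ℕ.+ c' ℕ.+ d'
+-cong₄ a b c d = cong₂ ℕ._+_ (cong₂ ℕ._+_ (cong₂ ℕ._+_ a b) c) d

absSum-swap-columns : ∀ a b c d → absSum (mat b a d c) ≡ absSum (mat a b c d)
absSum-swap-columns a b c d = swap (∣ a ∣) (∣ b ∣) (∣ c ∣) (∣ d ∣)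
  where
  swap : ∀ a b c d → b ℕ.+ a ℕ.+ d ℕ.+ c ≡ a ℕ.+ b ℕ.+ c ℕ.+ d
  swap = ℕ-Solver.solve-∀

absSum-swap-rows : ∀ a b c d → absSum (mat c d a b) ≡ absSum (mat a b c d)
absSum-swap-rows a b c d = swap (∣ a ∣) (∣ b ∣) (∣ c ∣) (∣ d ∣)
  where
  swap : ∀ a b c d → c ℕ.+ d ℕ.+ a ℕ.+ b ≡ a ℕ.+ b ℕ.+ c ℕ.+ d
  swap = ℕ-Solver.solve-∀

absSum-·ʳ : ∀ {σ} → SignedPermutation σ → ∀ Q → absSum (Q · σ) ≡ absSum Q
absSum-·ʳ (diagonal {u} {v} unit-u unit-v) (mat a b c d) = begin
  absSum (mat a b c d · mat u 0ℤ 0ℤ v)             ≡⟨ cong absSum (trans (·≡⊗ _ _) (mat-cong (e a b u) (e' a b v) (e c d u) (e' c d v))) ⟩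
  absSum (mat (a * u) (b * v) (c * u) (d * v))     ≡⟨ +-cong₄ (∣*Unit∣ a unit-u) (∣*Unit∣ b unit-v) (∣*Unit∣ c unit-u) (∣*Unit∣ d unit-v) ⟩
  absSum (mat a b c d)                             ∎
  where
  open ≡-Reasoning
  e : ∀ x y u → x * u + y * 0ℤ ≡ x * u
  e = solve-∀
  e' : ∀ x y v → x * 0ℤ + y * v ≡ y * v
  e' = solve-∀
absSum-·ʳ (antidiagonal {u} {v} unit-u unit-v) (mat a b c d) = begin
  absSum (mat a b c d · mat 0ℤ u v 0ℤ)             ≡⟨ cong absSum (trans (·≡⊗ _ _) (mat-cong (e a b v) (e' a b u) (e c d v) (e' c d u))) ⟩
  absSum (mat (b * v) (a * u) (d * v) (c * u))     ≡⟨ +-cong₄ (∣*Unit∣ b unit-v) (∣*Unit∣ a unit-u) (∣*Unit∣ d unit-v) (∣*Unit∣ c unit-u) ⟩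
  absSum (mat b a d c)                             ≡⟨ absSum-swap-columns a b c d ⟩
  absSum (mat a b c d)                             ∎
  where
  open ≡-Reasoning
  e : ∀ x y v → x * 0ℤ + y * v ≡ y * v
  e = solve-∀
  e' : ∀ x y u → x * u + y * 0ℤ ≡ x * u
  e' = solve-∀

absSum-·ˡ : ∀ {σ} → SignedPermutation σ → ∀ Q → absSum (σ · Q) ≡ absSum Q
absSum-·ˡ (diagonal {u} {v} unit-u unit-v) (mat a b c d) = begin
  absSum (mat u 0ℤ 0ℤ v · mat a b c d)             ≡⟨ cong absSum (trans (·≡⊗ _ _) (mat-cong (e u a c) (e u b d) (e' v a c) (e' v b d))) ⟩
  absSum (mat (u * a) (u * b) (v * c) (v * d))     ≡⟨ +-cong₄ (∣Unit*∣ a unit-u) (∣Unit*∣ b unit-u) (∣Unit*∣ c unit-v) (∣Unit*∣ d unit-v) ⟩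
  absSum (mat a b c d)                             ∎
  where
  open ≡-Reasoning
  e : ∀ u x y → u * x + 0ℤ * y ≡ u * x
  e = solve-∀
  e' : ∀ v x y → 0ℤ * x + v * y ≡ v * y
  e' = solve-∀
absSum-·ˡ (antidiagonal {u} {v} unit-u unit-v) (mat a b c d) = begin
  absSum (mat 0ℤ u v 0ℤ · mat a b c d)             ≡⟨ cong absSum (trans (·≡⊗ _ _) (mat-cong (e u a c) (e u b d) (e' v a c) (e' v b d))) ⟩
  absSum (mat (u * c) (u * d) (v * a) (v * b))     ≡⟨ +-cong₄ (∣Unit*∣ c unit-u) (∣Unit*∣ d unit-u) (∣Unit*∣ a unit-v) (∣Unit*∣ b unit-v) ⟩
  absSum (mat c d a b)                             ≡⟨ absSum-swap-rows a b c d ⟩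
  absSum (mat a b c d)                             ∎
  where
  open ≡-Reasoning
  e : ∀ u x y → 0ℤ * x + u * y ≡ u * y
  e = solve-∀
  e' : ∀ v x y → v * x + 0ℤ * y ≡ v * x
  e' = solve-∀

record PositiveDiagonal (P : Mat2) : Set where
  constructor positiveDiagonal
  field
    a b c d : ℕ
    shape   : P ≡ mat (+ a) (+ b) (+ c) (+ d)
    1≤a     : 1 ≤ a
    1≤d     : 1 ≤ d

PositiveDiagonal-I₂ : PositiveDiagonal I₂
PositiveDiagonal-I₂ = positiveDiagonal 1 0 0 1 refl ℕ.≤-refl ℕ.≤-refl

<-by-+ : ∀ {s k t} → t ≡ s ℕ.+ k → 1 ≤ k → s < t
<-by-+ {s} eq 1≤k = subst (s <_) (sym eq) (ℕ.m<m+n s 1≤k)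

private
  row-neg : ∀ x z → 0ℤ * x + - 1ℤ * z ≡ - z
  row-neg = solve-∀
  row-sum : ∀ x z → 1ℤ * x + 1ℤ * z ≡ x + z
  row-sum = solve-∀
  row-neg-sum : ∀ x z → - 1ℤ * x + - 1ℤ * z ≡ - (x + z)
  row-neg-sum = solve-∀
  row-first : ∀ x z → 1ℤ * x + 0ℤ * z ≡ x
  row-first = solve-∀
  column-first : ∀ x z → x * 1ℤ + z * 0ℤ ≡ x
  column-first = solve-∀
  column-sum : ∀ x z → x * 1ℤ + z * 1ℤ ≡ x + z
  column-sum = solve-∀
  column-second : ∀ x z → x * 0ℤ + z * 1ℤ ≡ z
  column-second = solve-∀

absSum-R· : ∀ {P} → PositiveDiagonal P → absSum P < absSum (φL R · P)
absSum-R· (positiveDiagonal a b c d refl _ 1≤d) =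
  <-by-+ (trans (cong absSum R·P) (trans (+-cong₄ (∣-i∣≡∣i∣ (+ c)) (∣-i∣≡∣i∣ (+ d)) refl refl) (rearrange a b c d)))
         (ℕ.≤-trans 1≤d (ℕ.m≤n+m d c))
  where
  R·P : φL R · mat (+ a) (+ b) (+ c) (+ d) ≡ mat (- + c) (- + d) (+ a + + c) (+ b + + d)
  R·P = trans (·≡⊗ _ _) (mat-cong (row-neg (+ a) (+ c)) (row-neg (+ b) (+ d)) (row-sum (+ a) (+ c)) (row-sum (+ b) (+ d)))
  rearrange : ∀ a b c d → c ℕ.+ d ℕ.+ (a ℕ.+ c) ℕ.+ (b ℕ.+ d) ≡ (a ℕ.+ b ℕ.+ c ℕ.+ d) ℕ.+ (c ℕ.+ d)
  rearrange = ℕ-Solver.solve-∀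

absSum-R²· : ∀ {P} → PositiveDiagonal P → absSum P < absSum (φL R · φL R · P)
absSum-R²· (positiveDiagonal a b c d refl 1≤a _) =
  <-by-+ (trans (cong absSum R²·P) (trans (+-cong₄ (∣-i∣≡∣i∣ (+ (a ℕ.+ c))) (∣-i∣≡∣i∣ (+ (b ℕ.+ d))) refl refl) (rearrange a b c d)))
         (ℕ.≤-trans 1≤a (ℕ.m≤m+n a b))
  where
  R²·P : φL R · φL R · mat (+ a) (+ b) (+ c) (+ d) ≡ mat (- (+ a + + c)) (- (+ b + + d)) (+ a) (+ b)
  R²·P = trans (cong (_· mat (+ a) (+ b) (+ c) (+ d)) (·≡⊗ (φL R) (φL R)))
           (trans (·≡⊗ _ _) (mat-cong (row-neg-sum (+ a) (+ c)) (row-neg-sum (+ b) (+ d)) (row-first (+ a) (+ c)) (row-first (+ b) (+ d))))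
  rearrange : ∀ a b c d → (a ℕ.+ c) ℕ.+ (b ℕ.+ d) ℕ.+ a ℕ.+ b ≡ (a ℕ.+ b ℕ.+ c ℕ.+ d) ℕ.+ (a ℕ.+ b)
  rearrange = ℕ-Solver.solve-∀

absSum-hexagon· : ∀ {e P} → part e ≡ hexagon → PositiveDiagonal P → absSum P < absSum (⟦ e ⟧ · P)
absSum-hexagon· {e} {P} e-hexagon positive with hexagon≡common·R∨R² e e-hexagon
... | c , c-common , decomposition = by-cases decomposition
  where
  via : ∀ {H} → ⟦ e ⟧ ≡ ⟦ c ⟧ · H → absSum P < absSum (H · P) → absSum P < absSum (⟦ e ⟧ · P)
  via {H} e≡cH = subst (absSum P <_) (begin
    absSum (H · P)            ≡⟨ absSum-·ˡ (signedPermutation c (common⇒¬hexagon c-common)) (H · P) ⟨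
    absSum (⟦ c ⟧ · (H · P))  ≡⟨ cong absSum (·-assoc ⟦ c ⟧ H P) ⟨
    absSum (⟦ c ⟧ · H · P)    ≡⟨ cong (λ E → absSum (E · P)) e≡cH ⟨
    absSum (⟦ e ⟧ · P)        ∎)
    where open ≡-Reasoning
  by-cases : ⟦ e ⟧ ≡ ⟦ c ⟧ · φL R ⊎ ⟦ e ⟧ ≡ ⟦ c ⟧ · (φL R · φL R) → absSum P < absSum (⟦ e ⟧ · P)
  by-cases (inj₁ e≡cR)  = via e≡cR  (absSum-R· positive)
  by-cases (inj₂ e≡cR²) = via e≡cR² (absSum-R²· positive)

·shear : ∀ {P} → PositiveDiagonal P → ∀ t → PositiveDiagonal (P · shear t) × absSum P < absSum (P · shear t)
·shear (positiveDiagonal a b c d refl 1≤a 1≤d) true =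
  positiveDiagonal a (a ℕ.+ b) c (c ℕ.+ d) P·T 1≤a (ℕ.≤-trans 1≤d (ℕ.m≤n+m d c)) ,
  <-by-+ (trans (cong absSum P·T) (rearrange a b c d)) (ℕ.≤-trans 1≤a (ℕ.m≤m+n a c))
  where
  P·T : mat (+ a) (+ b) (+ c) (+ d) · shear true ≡ mat (+ a) (+ a + + b) (+ c) (+ c + + d)
  P·T = trans (·≡⊗ _ _) (mat-cong (column-first (+ a) (+ b)) (column-sum (+ a) (+ b)) (column-first (+ c) (+ d)) (column-sum (+ c) (+ d)))
  rearrange : ∀ a b c d → a ℕ.+ (a ℕ.+ b) ℕ.+ c ℕ.+ (c ℕ.+ d) ≡ (a ℕ.+ b ℕ.+ c ℕ.+ d) ℕ.+ (a ℕ.+ c)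
  rearrange = ℕ-Solver.solve-∀
·shear (positiveDiagonal a b c d refl 1≤a 1≤d) false =
  positiveDiagonal (a ℕ.+ b) b (c ℕ.+ d) d P·L (ℕ.≤-trans 1≤a (ℕ.m≤m+n a b)) 1≤d ,
  <-by-+ (trans (cong absSum P·L) (rearrange a b c d)) (ℕ.≤-trans 1≤d (ℕ.m≤n+m d b))
  where
  P·L : mat (+ a) (+ b) (+ c) (+ d) · shear false ≡ mat (+ a + + b) (+ b) (+ c + + d) (+ d)
  P·L = trans (·≡⊗ _ _) (mat-cong (column-sum (+ a) (+ b)) (column-second (+ a) (+ b)) (column-sum (+ c) (+ d)) (column-second (+ c) (+ d)))
  rearrange : ∀ a b c d → a ℕ.+ b ℕ.+ b ℕ.+ (c ℕ.+ d) ℕ.+ d ≡ (a ℕ.+ b ℕ.+ c ℕ.+ d) ℕ.+ (b ℕ.+ d)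
  rearrange = ℕ-Solver.solve-∀

hexagonIndicator : Part → ℕ
hexagonIndicator hexagon = 1
hexagonIndicator _       = 0

hexagons : List Elt → ℕ
hexagons []       = 0
hexagons (e ∷ es) = hexagonIndicator (part e) ℕ.+ hexagons es

hexagons-∷-hexagon : ∀ e es → part e ≡ hexagon → hexagons (e ∷ es) ≡ suc (hexagons es)
hexagons-∷-hexagon e es e-hexagon = cong (λ p → hexagonIndicator p ℕ.+ hexagons es) e-hexagon

data Alternating : List Elt → Set where
  [_] : ∀ e → Alternating (e ∷ [])
  _∷_ : ∀ {e e' es} → Alternate e e' → Alternating (e' ∷ es) → Alternating (e ∷ e' ∷ es)

product : List Elt → Mat2
product []       = I₂
product (e ∷ es) = ⟦ e ⟧ · product es

-- In P · ⟦ m ⟧ the pending factor m can absorb the next letter e: a square one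
-- turns a hexagon letter into a shear, a common one a square letter into a square one.
Ready : Elt → Elt → Set
Ready m e = part m ≡ square × part e ≡ hexagon ⊎ part m ≡ common × part e ≡ square

record Move (P : Mat2) (m e : Elt) : Set where
  constructor move
  field
    P'             : Mat2
    m'             : Elt
    factorisation  : P · ⟦ m ⟧ · ⟦ e ⟧ ≡ P' · ⟦ m' ⟧
    positive       : PositiveDiagonal P'
    growth         : absSum P ℕ.+ hexagonIndicator (part e) ≤ absSum P'
    m'-not-hexagon : part m' ≢ hexagon
    ready          : ∀ {e'} → Alternate e e' → Ready m' e'

ping-pong-move : ∀ {P} m e → PositiveDiagonal P → Ready m e → Move P m e
ping-pong-move {P} m e positive (inj₁ (m-square , e-hexagon))
  with t , c , c-common , me≡tc ← square·hexagon≡shear·common m e m-square e-hexagon =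
  move (P · shear t) c factorisation (proj₁ (·shear positive t)) growth (common⇒¬hexagon c-common)
       (λ alternate → inj₂ (c-common , Alternate-hexagon alternate e-hexagon))
  where
  open ≡-Reasoning
  factorisation : P · ⟦ m ⟧ · ⟦ e ⟧ ≡ P · shear t · ⟦ c ⟧
  factorisation = begin
    P · ⟦ m ⟧ · ⟦ e ⟧      ≡⟨ ·-assoc P ⟦ m ⟧ ⟦ e ⟧ ⟩
    P · (⟦ m ⟧ · ⟦ e ⟧)    ≡⟨ cong (P ·_) me≡tc ⟩
    P · (shear t · ⟦ c ⟧)  ≡⟨ ·-assoc P (shear t) ⟦ c ⟧ ⟨
    P · shear t · ⟦ c ⟧    ∎
  growth : absSum P ℕ.+ hexagonIndicator (part e) ≤ absSum (P · shear t)
  growth = subst (λ k → absSum P ℕ.+ hexagonIndicator k ≤ _) (sym e-hexagon)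
             (subst (_≤ absSum (P · shear t)) (ℕ.+-comm 1 (absSum P)) (proj₂ (·shear positive t)))
ping-pong-move {P} m e positive (inj₂ (m-common , e-square))
  with a , a-square , me≡a ← common·square∈square m e m-common e-square =
  move P a (trans (·-assoc P ⟦ m ⟧ ⟦ e ⟧) (cong (P ·_) me≡a)) positive growth (square⇒¬hexagon a-square)
       (λ alternate → inj₁ (a-square , Alternate-square alternate e-square))
  where
  growth : absSum P ℕ.+ hexagonIndicator (part e) ≤ absSum P
  growth = subst (λ k → absSum P ℕ.+ hexagonIndicator k ≤ absSum P) (sym e-square)
             (ℕ.≤-reflexive (ℕ.+-identityʳ (absSum P)))

record Factored (M : Mat2) (bound : ℕ) : Set where
  constructor factored
  field
    P             : Mat2
    m             : Elt
    factorisation : M ≡ P · ⟦ m ⟧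
    positive      : PositiveDiagonal P
    large         : bound ≤ absSum P
    m-not-hexagon : part m ≢ hexagon

ping-pong : ∀ {P} m e es → PositiveDiagonal P → Ready m e → Alternating (e ∷ es) →
  Factored (P · ⟦ m ⟧ · product (e ∷ es)) (absSum P ℕ.+ hexagons (e ∷ es))
ping-pong {P} m e es positive ready alternating with ping-pong-move m e positive ready
ping-pong {P} m e [] positive ready [ e ] | move P' m' factorisation positive' growth m'-not-hexagon _ =
  factored P' m' (trans (cong (P · ⟦ m ⟧ ·_) (·-identityʳ ⟦ e ⟧)) factorisation) positive'
    (subst (_≤ absSum P') (cong (absSum P ℕ.+_) (sym (ℕ.+-identityʳ _))) growth)
    m'-not-hexagon
ping-pong {P} m e (e' ∷ es) positive ready (alternate ∷ alternating) | move P' m' factorisation positive' growth _ ready'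
  with factored P'' m'' factorisation' positive'' large m''-not-hexagon ← ping-pong m' e' es positive' (ready' alternate) alternating =
  factored P'' m'' (begin
      P · ⟦ m ⟧ · (⟦ e ⟧ · product (e' ∷ es))   ≡⟨ ·-assoc (P · ⟦ m ⟧) ⟦ e ⟧ _ ⟨
      P · ⟦ m ⟧ · ⟦ e ⟧ · product (e' ∷ es)     ≡⟨ cong (_· product (e' ∷ es)) factorisation ⟩
      P' · ⟦ m' ⟧ · product (e' ∷ es)           ≡⟨ factorisation' ⟩
      P'' · ⟦ m'' ⟧                             ∎)
    positive''
    (ℕ.≤-trans (ℕ.≤-reflexive (sym (ℕ.+-assoc (absSum P) _ _))) (ℕ.≤-trans (ℕ.+-monoˡ-≤ (hexagons (e' ∷ es)) growth) large))
    m''-not-hexagon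
  where open ≡-Reasoning

1≤hexagons : ∀ e es → part e ≡ hexagon → 1 ≤ hexagons (e ∷ es)
1≤hexagons e es e-hexagon = subst (1 ≤_) (sym (hexagons-∷-hexagon e es e-hexagon)) (s≤s z≤n)

hexagons-∷ : ∀ e es → hexagons es ≤ hexagons (e ∷ es)
hexagons-∷ e es = ℕ.m≤n+m (hexagons es) (hexagonIndicator (part e))

square-alternating-factored : ∀ {e es} → part e ≡ square → Alternating (e ∷ es) →
  Factored (product (e ∷ es)) (2 ℕ.+ hexagons (e ∷ es))
square-alternating-factored {e} {es} e-square alternating
  with factored P m factorisation positive large m-not-hexagon
       ← ping-pong γ₀ e es PositiveDiagonal-I₂ (inj₂ (refl , e-square)) alternating =
  factored P m (trans (sym I₂·I₂·M≡M) factorisation) positive large m-not-hexagon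
  where
  I₂·I₂·M≡M : I₂ · I₂ · product (e ∷ es) ≡ product (e ∷ es)
  I₂·I₂·M≡M = trans (cong (_· product (e ∷ es)) (·-identityˡ I₂)) (·-identityˡ _)

Factored⇒≤absSum : ∀ {M k} → Factored M k → k ≤ absSum M
Factored⇒≤absSum {k = k} (factored P m refl _ large m-not-hexagon) =
  subst (k ≤_) (sym (absSum-·ʳ (signedPermutation m m-not-hexagon) P)) large

absSum-·-factored : ∀ H {M P m} → M ≡ P · ⟦ m ⟧ → part m ≢ hexagon → absSum (H · M) ≡ absSum (H · P)
absSum-·-factored H {P = P} {m} refl m-not-hexagon =
  trans (cong absSum (sym (·-assoc H P ⟦ m ⟧))) (absSum-·ʳ (signedPermutation m m-not-hexagon) (H · P))

absSum>3-∉ : ∀ {M} → 4 ≤ absSum M → ∀ e → M ≢ ⟦ e ⟧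
absSum>3-∉ 4≤absSum e refl = ℕ.<⇒≱ (s≤s (absSum-⟦⟧≤3 e)) 4≤absSum

square-alternating-large : ∀ {e₁ e₂ e₃ e₄ es} → part e₁ ≡ square → Alternating (e₁ ∷ e₂ ∷ e₃ ∷ e₄ ∷ es) →
  4 ≤ absSum (product (e₁ ∷ e₂ ∷ e₃ ∷ e₄ ∷ es))
square-alternating-large {e₁} {e₂} {e₃} {e₄} {es} e₁-square alternating@(alternate ∷ (alternate' ∷ (alternate'' ∷ _))) =
  ℕ.≤-trans (ℕ.+-monoʳ-≤ 2 two-hexagons) (Factored⇒≤absSum (square-alternating-factored e₁-square alternating))
  where
  e₂-hexagon : part e₂ ≡ hexagon
  e₂-hexagon = Alternate-square alternate e₁-square
  e₄-hexagon : part e₄ ≡ hexagon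
  e₄-hexagon = Alternate-square alternate'' (Alternate-hexagon alternate' e₂-hexagon)
  two-hexagons : 2 ≤ hexagons (e₁ ∷ e₂ ∷ e₃ ∷ e₄ ∷ es)
  two-hexagons = ℕ.≤-trans (ℕ.≤-trans (s≤s (ℕ.≤-trans (1≤hexagons e₄ es e₄-hexagon) (hexagons-∷ e₃ (e₄ ∷ es))))
                                      (ℕ.≤-reflexive (sym (hexagons-∷-hexagon e₂ (e₃ ∷ e₄ ∷ es) e₂-hexagon))))
                           (hexagons-∷ e₁ (e₂ ∷ e₃ ∷ e₄ ∷ es))

hexagon-alternating-large : ∀ {e₁ e₂ e₃ es} → part e₁ ≡ hexagon → Alternating (e₁ ∷ e₂ ∷ e₃ ∷ es) →
  4 ≤ absSum (product (e₁ ∷ e₂ ∷ e₃ ∷ es))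
hexagon-alternating-large {e₁} {e₂} {e₃} {es} e₁-hexagon (alternate ∷ alternating@(alternate' ∷ _)) =
  subst (4 ≤_) (sym (absSum-·-factored ⟦ e₁ ⟧ factorisation m-not-hexagon))
    (ℕ.≤-<-trans 3≤absSum-P (absSum-hexagon· e₁-hexagon positive))
  where
  e₂-square : part e₂ ≡ square
  e₂-square = Alternate-hexagon alternate e₁-hexagon
  open Factored (square-alternating-factored e₂-square alternating)
  3≤absSum-P : 3 ≤ absSum P
  3≤absSum-P = ℕ.≤-trans (ℕ.+-monoʳ-≤ 2 (ℕ.≤-trans (1≤hexagons e₃ es (Alternate-square alternate' e₂-square)) (hexagons-∷ e₂ (e₃ ∷ es)))) large

alternating-∉ : ∀ {e₁ e₂ es} → Alternating (e₁ ∷ e₂ ∷ es) → ∀ e → product (e₁ ∷ e₂ ∷ es) ≢ ⟦ e ⟧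
alternating-∉ (alternate ∷ alternating) e with Alternate⇒parts alternate
alternating-∉ {e₁} {e₂} (alternate ∷ [ _ ]) e | _ = alternating₂-∉ e₁ e₂ alternate e
alternating-∉ {e₁} {e₂} (alternate ∷ (_∷_ {e' = e₃} alternate' [ _ ])) e | inj₁ (e₁-square , e₂-hexagon) =
  square-hexagon-square-∉ e₁ e₂ e₃ e₁-square e₂-hexagon (Alternate-hexagon alternate' e₂-hexagon) e
alternating-∉ (alternate ∷ alternating@(_ ∷ (_ ∷ _))) e | inj₁ (e₁-square , _) =
  absSum>3-∉ (square-alternating-large e₁-square (alternate ∷ alternating)) e
alternating-∉ (alternate ∷ alternating@(_ ∷ _)) e | inj₂ (e₁-hexagon , _) =
  absSum>3-∉ (hexagon-alternating-large e₁-hexagon (alternate ∷ alternating)) e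

-- Identity paths in finite graphs

-- A closed set of an inflationary operator on the subsets of a finite set, reached by
-- iterating from ∅: every step that changes the set enlarges it.
module Saturation {A : Set} (enum : List A) (complete : ∀ a → a ∈ enum)
  (F : (A → Bool) → A → Bool) (inflationary : ∀ K a → T (K a) → T (F K a))
  (Valid : A → Set) (F-valid : ∀ K → (∀ a → T (K a) → Valid a) → ∀ a → T (F K a) → Valid a) where

  _⊆_ : (A → Bool) → (A → Bool) → Set
  K ⊆ K' = ∀ a → T (K a) → T (K' a)

  Closed : (A → Bool) → Set
  Closed K = F K ⊆ K

  AllValid : (A → Bool) → Set
  AllValid K = ∀ a → T (K a) → Valid a

  count : (A → Bool) → List A → ℕ
  count K []       = 0
  count K (x ∷ xs) with K x
  ... | true  = suc (count K xs)
  ... | false = count K xs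

  count≤length : ∀ K xs → count K xs ≤ length xs
  count≤length K []       = z≤n
  count≤length K (x ∷ xs) with K x
  ... | true  = s≤s (count≤length K xs)
  ... | false = ℕ.m≤n⇒m≤1+n (count≤length K xs)

  count-mono : ∀ {K K'} → K ⊆ K' → ∀ xs → count K xs ≤ count K' xs
  count-mono         K⊆K' []       = z≤n
  count-mono {K} {K'} K⊆K' (x ∷ xs) with K x in Kx | K' x in K'x
  ... | true  | true  = s≤s (count-mono K⊆K' xs)
  ... | false | true  = ℕ.m≤n⇒m≤1+n (count-mono K⊆K' xs)
  ... | false | false = count-mono K⊆K' xs
  ... | true  | false = ⊥-elim (subst T K'x (K⊆K' x (subst T (sym Kx) _)))

  count-strict : ∀ {K K' x} → K ⊆ K' → ∀ xs → x ∈ xs → T (K' x) → ¬ T (K x) → count K xs < count K' xs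
  count-strict {K} {K'} K⊆K' (y ∷ xs) (here refl) K'y ¬Ky with K y | K' y
  ... | true  | _     = ⊥-elim (¬Ky _)
  ... | false | false = ⊥-elim K'y
  ... | false | true  = s≤s (count-mono K⊆K' xs)
  count-strict {K} {K'} K⊆K' (y ∷ xs) (there x∈xs) K'x ¬Kx with K y in Ky | K' y in K'y
  ... | true  | true  = s≤s (count-strict K⊆K' xs x∈xs K'x ¬Kx)
  ... | false | true  = ℕ.m≤n⇒m≤1+n (count-strict K⊆K' xs x∈xs K'x ¬Kx)
  ... | false | false = count-strict K⊆K' xs x∈xs K'x ¬Kx
  ... | true  | false = ⊥-elim (subst T K'y (K⊆K' y (subst T (sym Ky) _)))

  iterate : ∀ fuel K → length enum < count K enum ℕ.+ fuel → AllValid K →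
    Σ (A → Bool) λ K* → Closed K* × AllValid K*
  iterate fuel K bound valid
    with any? (λ a → T? (F K a) ×-dec ¬? (T? (K a))) enum
  ... | no nothing-new = K , closed , valid
    where
    closed : Closed K
    closed a FKa with T? (K a)
    ... | yes Ka = Ka
    ... | no ¬Ka = ⊥-elim (nothing-new (lose (complete a) (FKa , ¬Ka)))
  iterate zero K bound valid | yes _ =
    ⊥-elim (ℕ.<⇒≱ bound (ℕ.≤-trans (ℕ.≤-reflexive (ℕ.+-identityʳ _)) (count≤length K enum)))
  iterate (suc fuel) K bound valid | yes something-new
    with a , a∈enum , FKa , ¬Ka ← find something-new =
    iterate fuel (F K) bound' (F-valid K valid)
    where
    bound' : length enum < count (F K) enum ℕ.+ fuel
    bound' = ℕ.≤-trans bound (ℕ.≤-trans (ℕ.≤-reflexive (ℕ.+-suc _ fuel))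
               (ℕ.+-monoˡ-≤ fuel (count-strict (inflationary K) enum a∈enum FKa ¬Ka)))

  fixpoint : Σ (A → Bool) λ K* → Closed K* × AllValid K*
  fixpoint = iterate (suc (length enum)) ∅ (ℕ.≤-trans (ℕ.n<1+n _) (ℕ.m≤n+m _ (count ∅ enum))) (λ _ ())
    where
    ∅ : A → Bool
    ∅ _ = false

module EltGraph (V : Set) (_≟V_ : DecidableEquality V) (vertices : List V) (complete : ∀ v → v ∈ vertices)
                (edges : V → List (Elt × V)) where

  infixr 5 _◅_
  data Path : V → Mat2 → V → Set where
    ε   : ∀ {p} → Path p I₂ p
    _◅_ : ∀ {p e q M r} → (e , q) ∈ edges p → Path q M r → Path p (⟦ e ⟧ · M) r

  Path-subst : ∀ {p M M' r} → M ≡ M' → Path p M r → Path p M' r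
  Path-subst M≡M' = subst (λ M → Path _ M _) M≡M'

  infixr 5 _◅◅_
  _◅◅_ : ∀ {p M q M' r} → Path p M q → Path q M' r → Path p (M · M') r
  ε             ◅◅ path' = Path-subst (sym (·-identityˡ _)) path'
  (_◅_ {e = e} {M = M} edge path) ◅◅ path' = Path-subst (sym (·-assoc ⟦ e ⟧ M _)) (edge ◅ (path ◅◅ path'))

  -- (p , e , r) records that some path from p to r has product ⟦ e ⟧.
  Triple : Set
  Triple = V × Elt × V

  elts : List Elt
  elts = allFin 16

  Composite : (Triple → Bool) → V → Elt → V → Set
  Composite K p e r = Any (λ q → Any (λ e₁ → Any (λ e₂ →
    T (K (p , e₁ , q)) × T (K (q , e₂ , r)) × SameFactor e₁ e₂ × ⟦ e ⟧ ≡ ⟦ e₁ ⟧ · ⟦ e₂ ⟧) elts) elts) vertices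

  Rule : (Triple → Bool) → Triple → Set
  Rule K (p , e , r) = T (K (p , e , r)) ⊎ (e , r) ∈ edges p ⊎ (p ≡ r × ⟦ e ⟧ ≡ I₂) ⊎ Composite K p e r

  open DecMembership (≡-dec (Fin._≟_ {16}) _≟V_) using (_∈?_)

  rule? : ∀ K u → Dec (Rule K u)
  rule? K (p , e , r) =
    T? (K (p , e , r)) ⊎-dec (e , r) ∈? edges p ⊎-dec (p ≟V r ×-dec ⟦ e ⟧ ≟ₘ I₂) ⊎-dec
    any? (λ q → any? (λ e₁ → any? (λ e₂ →
      T? (K (p , e₁ , q)) ×-dec T? (K (q , e₂ , r)) ×-dec T? (sameFactor (part e₁) (part e₂)) ×-dec
      ⟦ e ⟧ ≟ₘ ⟦ e₁ ⟧ · ⟦ e₂ ⟧) elts) elts) vertices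

  derive : (Triple → Bool) → Triple → Bool
  derive K u = isYes (rule? K u)

  Realised : Triple → Set
  Realised (p , e , r) = Path p ⟦ e ⟧ r

  composite-realised : ∀ K → (∀ u → T (K u) → Realised u) → ∀ p e r → Composite K p e r → Realised (p , e , r)
  composite-realised K realised p e r composite
    with q , _ , some-e₁ ← find composite
    with e₁ , _ , some-e₂ ← find some-e₁
    with e₂ , _ , D₁ , D₂ , _ , e≡e₁e₂ ← find some-e₂ =
    Path-subst (sym e≡e₁e₂) (realised _ D₁ ◅◅ realised _ D₂)

  derive-realised : ∀ K → (∀ u → T (K u) → Realised u) → ∀ u → T (derive K u) → Realised u
  derive-realised K realised u derivable = by-rule u (toWitness derivable)
    where
    by-rule : ∀ u → Rule K u → Realised u
    by-rule u (inj₁ Ku) = realised u Ku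
    by-rule (p , e , r) (inj₂ (inj₁ edge)) = Path-subst (·-identityʳ ⟦ e ⟧) (edge ◅ ε)
    by-rule (p , e , .p) (inj₂ (inj₂ (inj₁ (refl , e≡I₂)))) = Path-subst (sym e≡I₂) ε
    by-rule (p , e , r) (inj₂ (inj₂ (inj₂ composite))) = composite-realised K realised p e r composite

  triples : List Triple
  triples = cartesianProduct vertices (cartesianProduct elts vertices)

  ∈-triples : ∀ u → u ∈ triples
  ∈-triples (p , e , r) = ∈-cartesianProduct⁺ (complete p) (∈-cartesianProduct⁺ (∈-allFin e) (complete r))

  open Saturation triples ∈-triples derive (λ K u Ku → fromWitness (inj₁ Ku)) Realised derive-realised
    using (fixpoint)

  opaque
    derived : Triple → Bool
    derived = proj₁ fixpoint

    derived-closed : ∀ u → T (derive derived u) → T (derived u)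
    derived-closed = proj₁ (proj₂ fixpoint)

    derived-realised : ∀ u → T (derived u) → Realised u
    derived-realised = proj₂ (proj₂ fixpoint)

  Derived : V → Elt → V → Set
  Derived p e r = T (derived (p , e , r))

  edge-derived : ∀ {p e q} → (e , q) ∈ edges p → Derived p e q
  edge-derived edge = derived-closed _ (fromWitness (inj₂ (inj₁ edge)))

  identity-derived : ∀ {p e} → ⟦ e ⟧ ≡ I₂ → Derived p e p
  identity-derived e≡I₂ = derived-closed _ (fromWitness (inj₂ (inj₂ (inj₁ (refl , e≡I₂)))))

  composite-derived : ∀ {p q r e e₁ e₂} → Derived p e₁ q → Derived q e₂ r → SameFactor e₁ e₂ →
    ⟦ e ⟧ ≡ ⟦ e₁ ⟧ · ⟦ e₂ ⟧ → Derived p e r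
  composite-derived {q = q} {e₁ = e₁} {e₂} D₁ D₂ same e≡e₁e₂ = derived-closed _ (fromWitness (inj₂ (inj₂ (inj₂
    (lose (complete q) (lose (∈-allFin e₁) (lose (∈-allFin e₂) (D₁ , D₂ , same , e≡e₁e₂))))))))

  data Chain : V → List Elt → V → Set where
    ε   : ∀ {p} → Chain p [] p
    _◅_ : ∀ {p e q es r} → Derived p e q → Chain q es r → Chain p (e ∷ es) r

  path⇒chain : ∀ {p M r} → Path p M r → Σ (List Elt) λ es → Chain p es r × product es ≡ M
  path⇒chain ε = [] , ε , refl
  path⇒chain (edge ◅ path) with es , chain , es≡M ← path⇒chain path =
    _ ∷ es , edge-derived edge ◅ chain , cong (_ ·_) es≡M

  record Shorter (p : V) (es : List Elt) (r : V) : Set where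
    constructor shorter
    field
      es'          : List Elt
      chain        : Chain p es' r
      length<      : length es' < length es
      same-product : product es' ≡ product es

  merge : ∀ {p e₁ e₂ es r} → Chain p (e₁ ∷ e₂ ∷ es) r → Shorter p (e₁ ∷ e₂ ∷ es) r ⊎ Alternating (e₁ ∷ e₂ ∷ es)
  merge {e₁ = e₁} {e₂} {es} (D₁ ◅ D₂ ◅ chain) with sameFactor-or-alternate e₁ e₂
  ... | inj₁ same with e , e≡e₁e₂ ← ·-closed e₁ e₂ same =
    inj₁ (shorter (e ∷ es) (composite-derived D₁ D₂ same e≡e₁e₂ ◅ chain) ℕ.≤-refl
                  (trans (cong (_· product es) e≡e₁e₂) (·-assoc ⟦ e₁ ⟧ ⟦ e₂ ⟧ (product es))))
  merge (D₁ ◅ D₂ ◅ ε) | inj₂ alternate = inj₂ (alternate ∷ [ _ ])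
  merge {e₁ = e₁} (D₁ ◅ chain@(_ ◅ _ ◅ _)) | inj₂ alternate with merge chain
  ... | inj₁ (shorter es' chain' length< same-product) =
    inj₁ (shorter (e₁ ∷ es') (D₁ ◅ chain') (s≤s length<) (cong (⟦ e₁ ⟧ ·_) same-product))
  ... | inj₂ alternating = inj₂ (alternate ∷ alternating)

  chain-derived : ∀ n {p es r} → length es ≤ n → Chain p es r → ∀ e → product es ≡ ⟦ e ⟧ → Derived p e r
  chain-derived _ _ ε e I₂≡e = identity-derived (sym I₂≡e)
  chain-derived _ _ (D ◅ ε) e e₁I₂≡e = composite-derived D (identity-derived {e = γ₀} refl) (SameFactor-γ₀ _) (sym e₁I₂≡e)
  chain-derived (suc n) (s≤s length≤n) chain@(_ ◅ _ ◅ _) e product≡e with merge chain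
  ... | inj₁ (shorter es' chain' length< same-product) =
    chain-derived n (ℕ.≤-trans (ℕ.≤-pred length<) length≤n) chain' e (trans same-product product≡e)
  ... | inj₂ alternating = ⊥-elim (alternating-∉ alternating e product≡e)

  identityPath? : ∀ s t → Dec (Path s I₂ t)
  identityPath? s t with T? (derived (s , γ₀ , t))
  ... | yes D = yes (derived-realised _ D)
  ... | no ¬D = no λ path → let es , chain , es≡I₂ = path⇒chain path in
                            ¬D (chain-derived (length es) ℕ.≤-refl chain γ₀ es≡I₂)

-- Identity paths in a word-labelled graph are decided in the graph obtained by
-- subdividing every edge into one edge per letter.
module WordGraph (V : Set) (_≟V_ : DecidableEquality V) (vertices : List V) (complete : ∀ v → v ∈ vertices)
                 (edges : V → List (List Letter × V)) where

  infixr 5 _◅_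
  data WordPath : V → Mat2 → V → Set where
    ε   : ∀ {p} → WordPath p I₂ p
    _◅_ : ∀ {p w q M r} → (w , q) ∈ edges p → WordPath q M r → WordPath p (φ w · M) r

  word : (p : V) → Fin (length (edges p)) → List Letter
  word p k = proj₁ (lookup (edges p) k)

  target : (p : V) → Fin (length (edges p)) → V
  target p k = proj₂ (lookup (edges p) k)

  -- (p , k , j): in the k-th edge out of p, just before reading the j-th letter
  Position : Set
  Position = Σ V λ p → Σ (Fin (length (edges p))) λ k → Fin (length (word p k))

  Node : Set
  Node = V ⊎ Position

  _≟ₙ_ : DecidableEquality Node
  _≟ₙ_ = Sum.≡-dec _≟V_ (≡-dec _≟V_ (≡-dec Fin._≟_ Fin._≟_))

  positionsOnEdge : (p : V) (k : Fin (length (edges p))) → List Position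
  positionsOnEdge p k = map (λ j → p , k , j) (allFin _)

  positionsFrom : V → List Position
  positionsFrom p = concatMap (positionsOnEdge p) (allFin _)

  positions : List Position
  positions = concatMap positionsFrom vertices

  nodes : List Node
  nodes = map inj₁ vertices ++ map inj₂ positions

  ∈-nodes : ∀ v → v ∈ nodes
  ∈-nodes (inj₁ p)           = ∈-++⁺ˡ (∈-map⁺ inj₁ (complete p))
  ∈-nodes (inj₂ (p , k , j)) = ∈-++⁺ʳ (map inj₁ vertices) (∈-map⁺ inj₂
    (∈-concatMap⁺ positionsFrom (lose (complete p)
      (∈-concatMap⁺ (positionsOnEdge p) (lose (∈-allFin k) (∈-map⁺ (λ j → p , k , j) (∈-allFin j)))))))

  -- the node from which the letters of w are read, given the nodes f of its positions
  -- and the node r reached at the end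
  entry : (w : List Letter) → (Fin (length w) → Node) → Node → Node
  entry []      f r = r
  entry (_ ∷ _) f r = f zero

  successor : (w : List Letter) → Fin (length w) → (Fin (length w) → Node) → Node → Node
  successor (_ ∷ w) zero    f r = entry w (λ j → f (suc j)) r
  successor (_ ∷ w) (suc j) f r = successor w j (λ j → f (suc j)) r

  position : (p : V) (k : Fin (length (edges p))) → Fin (length (word p k)) → Node
  position p k j = inj₂ (p , k , j)

  start : (p : V) → Fin (length (edges p)) → Node
  start p k = entry (word p k) (position p k) (inj₁ (target p k))

  letterEdges : Node → List (Elt × Node)
  letterEdges (inj₁ p)           = map (λ k → γ₀ , start p k) (allFin _)
  letterEdges (inj₂ (p , k , j)) =
    (letterElt (lookup (word p k) j) , successor (word p k) j (position p k) (inj₁ (target p k))) ∷ []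

  WordPath-Unit : ∀ {p M r} → WordPath p M r → Unit (det M)
  WordPath-Unit ε = inj₁ refl
  WordPath-Unit (_◅_ {w = w} {M = M} _ path) = subst Unit (sym (det-· (φ w) M)) (Unit-* (Unit-det-φ w) (WordPath-Unit path))

  private module Subdivided = EltGraph Node _≟ₙ_ nodes ∈-nodes letterEdges
  open Subdivided using (Path; ε; _◅_; Path-subst; identityPath?)

  WordPath-subst : ∀ {p M M' r} → M ≡ M' → WordPath p M r → WordPath p M' r
  WordPath-subst M≡M' = subst (λ M → WordPath _ M _) M≡M'

  infixr 5 _◅◅_
  _◅◅_ : ∀ {p M q M' r} → WordPath p M q → WordPath q M' r → WordPath p (M · M') r
  ε                               ◅◅ path' = WordPath-subst (sym (·-identityˡ _)) path'
  (_◅_ {w = w} {M = M} edge path) ◅◅ path' = WordPath-subst (sym (·-assoc (φ w) M _)) (edge ◅ (path ◅◅ path'))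

  reading : ∀ w (f : Fin (length w) → Node) r →
    (∀ j → (letterElt (lookup w j) , successor w j f r) ∈ letterEdges (f j)) → Path (entry w f r) (φ w) r
  reading []      f r _    = ε
  reading (x ∷ w) f r edge =
    Path-subst (trans (cong (_· φ w) (⟦letterElt⟧ x)) (sym (φ-∷ x w)))
      (edge zero ◅ reading w (λ j → f (suc j)) r (λ j → edge (suc j)))

  WordPath⇒Path : ∀ {p M r} → WordPath p M r → Path (inj₁ p) M (inj₁ r)
  WordPath⇒Path ε = ε
  WordPath⇒Path {p} {r = r} (_◅_ {w = w} {q} {M} w∈edges path) =
    Path-subst label≡ (∈-map⁺ (λ k → γ₀ , start p k) (∈-allFin k) ◅
      (reading (word p k) (position p k) (inj₁ (target p k)) (λ _ → here refl) Subdivided.◅◅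
       subst (λ t → Path (inj₁ t) M (inj₁ r)) q≡target (WordPath⇒Path path)))
    where
    k = index w∈edges
    w≡word : w ≡ word p k
    w≡word = ,-injectiveˡ (lookup-index w∈edges)
    q≡target : q ≡ target p k
    q≡target = ,-injectiveʳ (lookup-index w∈edges)
    label≡ : ⟦ γ₀ ⟧ · (φ (word p k) · M) ≡ φ w · M
    label≡ = trans (·-identityˡ _) (cong (λ w → φ w · M) (sym w≡word))

  suffix : Position → List Letter
  suffix (p , k , j) = drop (toℕ j) (word p k)

  -- what a path from a node to a vertex of the word graph still has to read
  Pending : Node → Mat2 → V → Set
  Pending (inj₁ p)               M r = WordPath p M r
  Pending (inj₂ u@(p , k , _)) M r = Σ Mat2 λ M' → M ≡ φ (suffix u) · M' × WordPath (target p k) M' r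

  data EntryView (w : List Letter) (f : Fin (length w) → Node) (r : Node) : Set where
    empty-word : w ≡ [] → entry w f r ≡ r → EntryView w f r
    first-letter : ∀ j → toℕ j ≡ 0 → entry w f r ≡ f j → EntryView w f r

  entryView : ∀ w f r → EntryView w f r
  entryView []      f r = empty-word refl refl
  entryView (x ∷ w) f r = first-letter zero refl refl

  data SuccessorView (w : List Letter) (j : Fin (length w)) (f : Fin (length w) → Node) (r : Node) : Set where
    last-letter : drop (suc (toℕ j)) w ≡ [] → successor w j f r ≡ r → SuccessorView w j f r
    next-letter : ∀ j' → toℕ j' ≡ suc (toℕ j) → successor w j f r ≡ f j' → SuccessorView w j f r

  successorView : ∀ w j f r → SuccessorView w j f r
  successorView (x ∷ [])    zero    f r = last-letter refl refl
  successorView (x ∷ y ∷ w) zero    f r = next-letter (suc zero) refl refl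
  successorView (x ∷ w)     (suc j) f r with successorView w j (λ j → f (suc j)) r
  ... | last-letter rest≡[] successor≡r   = last-letter rest≡[] successor≡r
  ... | next-letter j' j'≡1+j successor≡f = next-letter (suc j') (cong suc j'≡1+j) successor≡f

  drop-lookup : ∀ (w : List Letter) j → drop (toℕ j) w ≡ lookup w j ∷ drop (suc (toℕ j)) w
  drop-lookup (x ∷ w) zero    = refl
  drop-lookup (x ∷ w) (suc j) = drop-lookup w j

  start-pending : ∀ p k {v M r} → v ≡ start p k → Pending v M r → WordPath p (⟦ γ₀ ⟧ · M) r
  start-pending p k {v} {M} {r} v≡start pending with entryView (word p k) (position p k) (inj₁ (target p k))
  ... | empty-word word≡[] entry≡target =
    subst (λ M → WordPath p M r) (cong (λ w → φ w · M) word≡[]) (∈-lookup k ◅ subst (λ v → Pending v M r) (trans v≡start entry≡target) pending)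
  ... | first-letter j j≡0 entry≡j
    with M' , M≡ , path ← subst (λ v → Pending v M r) (trans v≡start entry≡j) pending =
    subst (λ M → WordPath p M r) label≡ (∈-lookup k ◅ path)
    where
    label≡ : φ (word p k) · M' ≡ ⟦ γ₀ ⟧ · M
    label≡ = trans (cong (λ n → φ (drop n (word p k)) · M') (sym j≡0)) (trans (sym M≡) (sym (·-identityˡ M)))

  position-pending : ∀ p k j {v M r} → v ≡ successor (word p k) j (position p k) (inj₁ (target p k)) → Pending v M r →
    Pending (position p k j) (⟦ letterElt (lookup (word p k) j) ⟧ · M) r
  position-pending p k j {v} {M} {r} v≡successor pending with successorView (word p k) j (position p k) (inj₁ (target p k))
  ... | last-letter rest≡[] successor≡target = M , label≡ , subst (λ v → Pending v M r) (trans v≡successor successor≡target) pending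
    where
    x = lookup (word p k) j
    label≡ : ⟦ letterElt x ⟧ · M ≡ φ (drop (toℕ j) (word p k)) · M
    label≡ = cong (_· M) (begin
      ⟦ letterElt x ⟧                           ≡⟨ ⟦letterElt⟧ x ⟩
      φL x                                      ≡⟨ φ-[ x ] ⟨
      φ (x ∷ [])                                ≡⟨ cong (λ w → φ (x ∷ w)) rest≡[] ⟨
      φ (x ∷ drop (suc (toℕ j)) (word p k))     ≡⟨ cong φ (drop-lookup (word p k) j) ⟨
      φ (drop (toℕ j) (word p k))               ∎)
      where open ≡-Reasoning
  ... | next-letter j' j'≡1+j successor≡j'
    with M' , M≡ , path ← subst (λ v → Pending v M r) (trans v≡successor successor≡j') pending =
    M' , label≡ , path
    where
    x = lookup (word p k) j
    rest = drop (suc (toℕ j)) (word p k)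
    label≡ : ⟦ letterElt x ⟧ · M ≡ φ (drop (toℕ j) (word p k)) · M'
    label≡ = begin
      ⟦ letterElt x ⟧ · M                        ≡⟨ cong₂ _·_ (⟦letterElt⟧ x) M≡ ⟩
      φL x · (φ (drop (toℕ j') (word p k)) · M') ≡⟨ cong (λ n → φL x · (φ (drop n (word p k)) · M')) j'≡1+j ⟩
      φL x · (φ rest · M')                       ≡⟨ ·-assoc (φL x) (φ rest) M' ⟨
      φL x · φ rest · M'                         ≡⟨ cong (_· M') (φ-∷ x rest) ⟨
      φ (x ∷ rest) · M'                          ≡⟨ cong (λ w → φ w · M') (drop-lookup (word p k) j) ⟨
      φ (drop (toℕ j) (word p k)) · M'           ∎
      where open ≡-Reasoning

  Path⇒Pending : ∀ {v M r} → Path v M (inj₁ r) → Pending v M r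
  Path⇒Pending ε = ε
  Path⇒Pending {inj₁ p} {r = r} (_◅_ {e = e} {M = M} edge path) with k , _ , e,q≡ ← ∈-map⁻ (λ k → γ₀ , start p k) edge =
    subst (λ e → WordPath p (⟦ e ⟧ · M) r) (sym (,-injectiveˡ e,q≡)) (start-pending p k (,-injectiveʳ e,q≡) (Path⇒Pending path))
  Path⇒Pending {inj₂ (p , k , j)} {r = r} (_◅_ {e = e} {M = M} (here e,q≡) path) =
    subst (λ e → Pending (position p k j) (⟦ e ⟧ · M) r) (sym (,-injectiveˡ e,q≡))
      (position-pending p k j (,-injectiveʳ e,q≡) (Path⇒Pending path))

  identityWordPath? : ∀ s t → Dec (WordPath s I₂ t)
  identityWordPath? s t with identityPath? (inj₁ s) (inj₁ t)
  ... | yes path = yes (Path⇒Pending path)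
  ... | no ¬path = no λ path → ¬path (WordPath⇒Path path)

fromDec : ∀ {A P : Set} → Dec P → (P → A) → List A
fromDec (yes p) f = f p ∷ []
fromDec (no _)  f = []

∈-fromDec⁻ : ∀ {A P : Set} (P? : Dec P) (f : P → A) {y} → y ∈ fromDec P? f → Σ P λ p → y ≡ f p
∈-fromDec⁻ (yes p) f (here y≡fp) = p , y≡fp

∈-fromDec⁺ : ∀ {A P : Set} (P? : Dec P) (f : P → A) → P → Σ P λ p → f p ∈ fromDec P? f
∈-fromDec⁺ (yes p) f _ = p , here refl
∈-fromDec⁺ (no ¬p) f p = ⊥-elim (¬p p)

letters : List Letter
letters = X ∷ N ∷ S ∷ R ∷ []

∈-letters : ∀ x → x ∈ letters
∈-letters X = here refl
∈-letters N = there (here refl)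
∈-letters S = there (there (here refl))
∈-letters R = there (there (there (here refl)))

signs : List Sign
signs = Sign.+ ∷ Sign.- ∷ []

∈-signs : ∀ s → s ∈ signs
∈-signs Sign.+ = here refl
∈-signs Sign.- = there (here refl)

-- The finite graph of the problem

module Reduction (n : ℤ) (n≢0 : n ≢ 0ℤ) (A₁ A₂ : DFA) where

  open DFA A₁ using () renaming (nStates to K₁; start to s₁; δ to δ₁; final to final₁)
  open DFA A₂ using () renaming (nStates to K₂; start to s₂; δ to δ₂; final to final₂)

  Code : Set
  Code = Fin (suc ∣ n ∣) × Fin (suc ∣ n ∣) × Fin (suc ∣ n ∣) × Sign

  decode : Code → Mat2
  decode (a , b , d , s) = upper (toℕ a) (+ toℕ b) (s ◃ toℕ d)

  codes : List Code
  codes = cartesianProduct (allFin _) (cartesianProduct (allFin _) (cartesianProduct (allFin _) signs))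

  ∈-codes : ∀ c → c ∈ codes
  ∈-codes (a , b , d , s) =
    ∈-cartesianProduct⁺ (∈-allFin a) (∈-cartesianProduct⁺ (∈-allFin b) (∈-cartesianProduct⁺ (∈-allFin d) (∈-signs s)))

  code? : ∀ M → Dec (Σ Code λ c → decode c ≡ M)
  code? M with any? (λ c → decode c ≟ₘ M) codes
  ... | yes found  = yes (satisfied found)
  ... | no ¬found  = no λ (c , c≡M) → ¬found (lose (∈-codes c) c≡M)

  bounded-code : ∀ {a r d} → a ≤ ∣ n ∣ → r ≤ ∣ n ∣ → ∣ d ∣ ≤ ∣ n ∣ → Σ Code λ c → decode c ≡ upper a (+ r) d
  bounded-code {a} {r} {d} a≤ r≤ d≤ =
    (fromℕ< (s≤s a≤) , fromℕ< (s≤s r≤) , fromℕ< (s≤s d≤) , sign d) ,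
    mat-cong (cong +_ (Fin.toℕ-fromℕ< (s≤s a≤))) (cong +_ (Fin.toℕ-fromℕ< (s≤s r≤))) refl
             (trans (cong (sign d ◃_) (Fin.toℕ-fromℕ< (s≤s d≤))) (◃-inverse d))

  diag₁-code : Σ Code λ c → decode c ≡ diag₁ n
  diag₁-code = bounded-code (ℕ.n≢0⇒n>0 (λ ∣n∣≡0 → n≢0 (∣i∣≡0⇒i≡0 ∣n∣≡0))) z≤n ℕ.≤-refl

  Vertex : Set
  Vertex = Fin K₁ ⊎ (Fin K₂ × Code) ⊎ ⊤

  -- reading the word of A₁, reading the word of A₂ (with the current Hermite form), done
  pattern first q    = inj₁ q
  pattern second q c = inj₂ (inj₁ (q , c))
  pattern done       = inj₂ (inj₂ tt)

  _≟ᵥ_ : DecidableEquality Vertex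
  _≟ᵥ_ = Sum.≡-dec Fin._≟_ (Sum.≡-dec (≡-dec Fin._≟_ (≡-dec Fin._≟_ (≡-dec Fin._≟_ (≡-dec Fin._≟_ _≟ˢ_)))) _≟ᵘ_)

  vertices : List Vertex
  vertices = map first (allFin _) ++ map (λ (q , c) → second q c) (cartesianProduct (allFin _) codes) ++ done ∷ []

  ∈-vertices : ∀ v → v ∈ vertices
  ∈-vertices (first q)    = ∈-++⁺ˡ (∈-map⁺ first (∈-allFin q))
  ∈-vertices (second q c) = ∈-++⁺ʳ (map first (allFin _))
    (∈-++⁺ˡ (∈-map⁺ (λ (q , c) → second q c) (∈-cartesianProduct⁺ (∈-allFin q) (∈-codes c))))
  ∈-vertices done         = ∈-++⁺ʳ (map first (allFin _)) (∈-++⁺ʳ (map (λ (q , c) → second q c) (cartesianProduct (allFin _) codes)) (here refl))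

  Edge : Set
  Edge = List Letter × Vertex

  letterEdge : Fin K₁ → Letter → Edge
  letterEdge q x = x ∷ [] , first (δ₁ q x)

  startEdges : Fin K₁ → List Edge
  startEdges q = fromDec (final₁ q ≟ᵇ true) λ _ → [] , second s₂ (proj₁ diag₁-code)

  hermiteEdge : ∀ {Q} → Fin K₂ → Letter → HermiteDecomposition Q → List Edge
  hermiteEdge q x (hermite w a b d _ _) = fromDec (code? (upper a b d)) λ (c , _) → w , second (δ₂ q x) c

  hermiteEdges : Fin K₂ → Code → Letter → List Edge
  hermiteEdges q c x = hermiteEdge q x (hermiteDecomposition (decode c · φL x))

  doneEdges : Fin K₂ → Code → List Edge
  doneEdges q c = fromDec (final₂ q ≟ᵇ true ×-dec decode c ≟ₘ diag₁ n) (λ _ → [] , done) ++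
                  fromDec (final₂ q ≟ᵇ true ×-dec decode c ≟ₘ diag₁ (- n)) (λ _ → N ∷ [] , done)

  edges : Vertex → List Edge
  edges (first q)    = map (letterEdge q) letters ++ startEdges q
  edges (second q c) = concatMap (hermiteEdges q c) letters ++ doneEdges q c
  edges done         = []

  open WordGraph Vertex _≟ᵥ_ vertices ∈-vertices edges using (WordPath; ε; _◅_; _◅◅_; WordPath-subst; WordPath-Unit; identityWordPath?)

  Solution : Set
  Solution = Σ (List Letter) λ w₁ → Σ (List Letter) λ w₂ →
    Accepts A₁ w₁ × Accepts A₂ w₂ × φ w₁ · diag₁ n · φ w₂ ≡ diag₁ n

  -- what a path from the start with product M guarantees on arriving at a vertex
  Reached : Vertex → Mat2 → Set
  Reached (first q)    M = Σ (List Letter) λ w₁ → run A₁ s₁ w₁ ≡ q × φ w₁ ≡ M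
  Reached (second q c) M = Σ (List Letter) λ w₁ → Σ (List Letter) λ w₂ →
    Accepts A₁ w₁ × run A₂ s₂ w₂ ≡ q × φ w₁ · diag₁ n · φ w₂ ≡ M · decode c
  Reached done         M = Σ (List Letter) λ w₁ → Σ (List Letter) λ w₂ →
    Accepts A₁ w₁ × Accepts A₂ w₂ × φ w₁ · diag₁ n · φ w₂ ≡ M · diag₁ n

  first-Reached : ∀ {q M w v} → Reached (first q) M → (w , v) ∈ edges (first q) → Reached v (M · φ w)
  first-Reached {q} {M} (w₁ , run≡q , φw₁≡M) edge with ∈-++⁻ (map (letterEdge q) letters) edge
  ... | inj₁ letter with x , _ , refl ← ∈-map⁻ (letterEdge q) letter =
    w₁ ++ x ∷ [] , trans (run-∷ʳ A₁ s₁ w₁ x) (cong (λ q → δ₁ q x) run≡q) , trans (φ-++ w₁ (x ∷ [])) (cong (_· φ (x ∷ [])) φw₁≡M)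
  ... | inj₂ start with final , refl ← ∈-fromDec⁻ (final₁ q ≟ᵇ true) _ start =
    w₁ , [] , trans (cong final₁ run≡q) final , refl , (begin
      φ w₁ · diag₁ n · I₂                  ≡⟨ ·-identityʳ _ ⟩
      φ w₁ · diag₁ n                       ≡⟨ cong₂ _·_ φw₁≡M (sym (proj₂ diag₁-code)) ⟩
      M · decode (proj₁ diag₁-code)        ≡⟨ cong (_· decode (proj₁ diag₁-code)) (·-identityʳ M) ⟨
      M · I₂ · decode (proj₁ diag₁-code)   ∎)
    where open ≡-Reasoning

  hermite-Reached : ∀ {q c M x w v} (H : HermiteDecomposition (decode c · φL x)) →
    Reached (second q c) M → (w , v) ∈ hermiteEdge q x H → Reached v (M · φ w)
  hermite-Reached {q} {c} {M} {x} (hermite w a b d factorisation _) (w₁ , w₂ , accepts₁ , run≡q , solution) edge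
    with (c' , c'≡) , refl ← ∈-fromDec⁻ (code? (upper a b d)) _ edge =
    w₁ , w₂ ++ x ∷ [] , accepts₁ , trans (run-∷ʳ A₂ s₂ w₂ x) (cong (λ q → δ₂ q x) run≡q) , (begin
      φ w₁ · diag₁ n · φ (w₂ ++ x ∷ [])        ≡⟨ cong (φ w₁ · diag₁ n ·_) (φ-∷ʳ w₂ x) ⟩
      φ w₁ · diag₁ n · (φ w₂ · φL x)           ≡⟨ ·-assoc _ (φ w₂) (φL x) ⟨
      φ w₁ · diag₁ n · φ w₂ · φL x             ≡⟨ cong (_· φL x) solution ⟩
      M · decode c · φL x                      ≡⟨ ·-assoc M (decode c) (φL x) ⟩
      M · (decode c · φL x)                    ≡⟨ cong (M ·_) factorisation ⟩
      M · (φ w · upper a b d)                  ≡⟨ ·-assoc M (φ w) _ ⟨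
      M · φ w · upper a b d                    ≡⟨ cong (M · φ w ·_) c'≡ ⟨
      M · φ w · decode c'                      ∎)
    where open ≡-Reasoning

  second-Reached : ∀ {q c M w v} → Reached (second q c) M → (w , v) ∈ edges (second q c) → Reached v (M · φ w)
  second-Reached {q} {c} {M} reached edge with ∈-++⁻ (concatMap (hermiteEdges q c) letters) edge
  ... | inj₁ step with x , step-x ← satisfied (∈-concatMap⁻ (hermiteEdges q c) {xs = letters} step) =
    hermite-Reached (hermiteDecomposition (decode c · φL x)) reached step-x
  ... | inj₂ finish with w₁ , w₂ , accepts₁ , run≡q , solution ← reached
                     with ∈-++⁻ (fromDec (final₂ q ≟ᵇ true ×-dec decode c ≟ₘ diag₁ n) _) finish
  ...   | inj₁ identity with (final , c≡) , refl ← ∈-fromDec⁻ (final₂ q ≟ᵇ true ×-dec decode c ≟ₘ diag₁ n) _ identity =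
    w₁ , w₂ , accepts₁ , trans (cong final₂ run≡q) final , trans solution (trans (cong (M ·_) c≡) (cong (_· diag₁ n) (sym (·-identityʳ M))))
  ...   | inj₂ flip with (final , c≡) , refl ← ∈-fromDec⁻ (final₂ q ≟ᵇ true ×-dec decode c ≟ₘ diag₁ (- n)) _ flip =
    w₁ , w₂ , accepts₁ , trans (cong final₂ run≡q) final ,
    trans solution (trans (cong (M ·_) (trans c≡ (sym (trans (cong (_· diag₁ n) φ-[ N ]) (φN·diag₁ n))))) (sym (·-assoc M _ (diag₁ n))))

  edge-Reached : ∀ {u M w v} → Reached u M → (w , v) ∈ edges u → Reached v (M · φ w)
  edge-Reached {first q}    = first-Reached
  edge-Reached {second q c} = second-Reached
  edge-Reached {done}       _ ()

  path-Reached : ∀ {u M₀ M v} → Reached u M₀ → WordPath u M v → Reached v (M₀ · M)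
  path-Reached {u} {M₀} reached ε = subst (Reached u) (sym (·-identityʳ M₀)) reached
  path-Reached {M₀ = M₀} reached (_◅_ {w = w} {M = M} edge path) =
    subst (Reached _) (·-assoc M₀ (φ w) M) (path-Reached (edge-Reached reached edge) path)

  sound : WordPath (first s₁) I₂ done → Solution
  sound path with w₁ , w₂ , accepts₁ , accepts₂ , solution ← path-Reached ([] , refl , refl) path =
    w₁ , w₂ , accepts₁ , accepts₂ , trans solution (trans (cong (_· diag₁ n) (·-identityˡ I₂)) (·-identityˡ (diag₁ n)))

  first-path : ∀ q w → WordPath (first q) (φ w) (first (run A₁ q w))
  first-path q []      = ε
  first-path q (x ∷ w) =
    WordPath-subst (trans (cong (_· φ w) φ-[ x ]) (sym (φ-∷ x w)))
      (∈-++⁺ˡ (∈-map⁺ (letterEdge q) (∈-letters x)) ◅ first-path (δ₁ q x) w)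

  record Tracked (c : Code) : Set where
    constructor tracked
    field
      a       : ℕ
      b d     : ℤ
      shape   : decode c ≡ upper a b d
      reduced : Reduced b d
      u       : ℤ
      unit    : Unit u
      det≡    : det (decode c) ≡ u * n

  tracked₀ : Tracked (proj₁ diag₁-code)
  tracked₀ = tracked 1 0ℤ n (proj₂ diag₁-code) reduced₀ 1ℤ (inj₁ refl) (trans (cong det (proj₂ diag₁-code)) (det-diag₁ n))
    where
    reduced₀ : Reduced 0ℤ n
    reduced₀ n≢0 = 0 , refl , ℕ.n≢0⇒n>0 (λ ∣n∣≡0 → n≢0 (∣i∣≡0⇒i≡0 ∣n∣≡0))
    det-diag₁ : ∀ n → 1ℤ * n + - (0ℤ * 0ℤ) ≡ 1ℤ * n
    det-diag₁ = solve-∀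

  hermite-step : ∀ q c x (H : HermiteDecomposition (decode c · φL x)) → Tracked c →
    Σ Code λ c' → Σ (List Letter) λ w → (w , second (δ₂ q x) c') ∈ hermiteEdge q x H ×
      decode c · φL x ≡ φ w · decode c' × Tracked c'
  hermite-step q c x (hermite w a b d factorisation reduced) (tracked _ _ _ _ _ u unit-u det≡un) =
    c' , w , edge , trans factorisation (cong (φ w ·_) (sym c'≡)) ,
    tracked a b d c'≡ reduced (t * u * v) unit-tuv (trans (cong det c'≡) det-upper)
    where
    t = det (φ w)
    v = det (φL x)
    unit-tuv : Unit (t * u * v)
    unit-tuv = Unit-* (Unit-* (Unit-det-φ w) unit-u) (Unit-det-φL x)
    det-upper : det (upper a b d) ≡ t * u * v * n
    det-upper = trans (Unit-inverse (Unit-det-φ w) _ _ (begin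
      t * det (upper a b d)        ≡⟨ det-· (φ w) (upper a b d) ⟨
      det (φ w · upper a b d)      ≡⟨ cong det factorisation ⟨
      det (decode c · φL x)        ≡⟨ det-· (decode c) (φL x) ⟩
      det (decode c) * v           ≡⟨ cong (_* v) det≡un ⟩
      u * n * v                    ∎)) (regroup t u n v)
      where
      open ≡-Reasoning
      regroup : ∀ t u n v → t * (u * n * v) ≡ t * u * v * n
      regroup = solve-∀
    has-code : Σ Code λ c → decode c ≡ upper a b d
    has-code = code-of (upper-bounds a b d n≢0 unit-tuv det-upper)
      where
      code-of : a ≤ ∣ n ∣ × ∣ d ∣ ≤ ∣ n ∣ × d ≢ 0ℤ → Σ Code λ c → decode c ≡ upper a b d
      code-of (a≤∣n∣ , ∣d∣≤∣n∣ , d≢0) with r , b≡r , r<∣d∣ ← reduced d≢0 =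
        subst (λ b → Σ Code λ c → decode c ≡ upper a b d) (sym b≡r)
          (bounded-code a≤∣n∣ (ℕ.≤-trans (ℕ.<⇒≤ r<∣d∣) ∣d∣≤∣n∣) ∣d∣≤∣n∣)
    found : Σ (Σ Code λ c → decode c ≡ upper a b d) λ (c' , _) → (w , second (δ₂ q x) c') ∈ hermiteEdge q x (hermite w a b d factorisation reduced)
    found = ∈-fromDec⁺ (code? (upper a b d)) (λ (c' , _) → w , second (δ₂ q x) c') has-code
    c' : Code
    c' = proj₁ (proj₁ found)
    c'≡ : decode c' ≡ upper a b d
    c'≡ = proj₂ (proj₁ found)
    edge : (w , second (δ₂ q x) c') ∈ hermiteEdge q x (hermite w a b d factorisation reduced)
    edge = proj₂ found

  second-path : ∀ q w c → Tracked c → Σ Code λ c' → Σ Mat2 λ h →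
    WordPath (second q c) h (second (run A₂ q w) c') × decode c · φ w ≡ h · decode c' × Tracked c'
  second-path q []      c tracked-c = c , I₂ , ε , trans (·-identityʳ _) (sym (·-identityˡ _)) , tracked-c
  second-path q (x ∷ w) c tracked-c =
    let c₁ , w₁ , edge , step≡ , tracked-c₁ = hermite-step q c x (hermiteDecomposition (decode c · φL x)) tracked-c
        c' , h , path , path≡ , tracked-c' = second-path (δ₂ q x) w c₁ tracked-c₁
    in c' , φ w₁ · h , ∈-++⁺ˡ (∈-concatMap⁺ (hermiteEdges q c) (lose (∈-letters x) edge)) ◅ path , (begin
      decode c · φ (x ∷ w)        ≡⟨ cong (decode c ·_) (φ-∷ x w) ⟩
      decode c · (φL x · φ w)     ≡⟨ ·-assoc (decode c) (φL x) (φ w) ⟨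
      decode c · φL x · φ w       ≡⟨ cong (_· φ w) step≡ ⟩
      φ w₁ · decode c₁ · φ w      ≡⟨ ·-assoc (φ w₁) (decode c₁) (φ w) ⟩
      φ w₁ · (decode c₁ · φ w)    ≡⟨ cong (φ w₁ ·_) path≡ ⟩
      φ w₁ · (h · decode c')      ≡⟨ ·-assoc (φ w₁) h (decode c') ⟨
      φ w₁ · h · decode c'        ∎) , tracked-c'
    where open ≡-Reasoning

  closing-edge : ∀ {q c G} → final₂ q ≡ true → Tracked c → Unit (det G) → G · decode c ≡ diag₁ n →
    Σ (List Letter) λ k → (k , done) ∈ edges (second q c) × G · φ k ≡ I₂
  closing-edge {q} {c} {G} final (tracked a b d shape reduced _ _ _) unit-G G·c≡diag₁ =
    by-cases (unimodular-upper≡diag₁ n≢0 G a b d unit-G reduced (trans (cong (G ·_) (sym shape)) G·c≡diag₁))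
    where
    open ≡-Reasoning
    done-edge : ∀ {k} → (k , done) ∈ doneEdges q c → (k , done) ∈ edges (second q c)
    done-edge = ∈-++⁺ʳ (concatMap (hermiteEdges q c) letters)
    inverse : ∀ P → P · diag₁ n ≡ decode c → G · P ≡ I₂
    inverse P P·diag₁≡c = ·-cancelʳ-diag₁ n≢0 (G · P) I₂ (begin
      G · P · diag₁ n      ≡⟨ ·-assoc G P (diag₁ n) ⟩
      G · (P · diag₁ n)    ≡⟨ cong (G ·_) P·diag₁≡c ⟩
      G · decode c         ≡⟨ G·c≡diag₁ ⟩
      diag₁ n              ≡⟨ ·-identityˡ _ ⟨
      I₂ · diag₁ n         ∎)
    by-cases : upper a b d ≡ diag₁ n ⊎ upper a b d ≡ diag₁ (- n) →
      Σ (List Letter) λ k → (k , done) ∈ edges (second q c) × G · φ k ≡ I₂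
    by-cases (inj₁ upper≡diag₁) =
      [] , done-edge (∈-++⁺ˡ (proj₂ (∈-fromDec⁺ (final₂ q ≟ᵇ true ×-dec decode c ≟ₘ diag₁ n) _ (final , c≡diag₁)))) ,
      inverse I₂ (trans (·-identityˡ _) (sym c≡diag₁))
      where
      c≡diag₁ : decode c ≡ diag₁ n
      c≡diag₁ = trans shape upper≡diag₁
    by-cases (inj₂ upper≡diag₁-) =
      N ∷ [] , done-edge (∈-++⁺ʳ (fromDec (final₂ q ≟ᵇ true ×-dec decode c ≟ₘ diag₁ n) _)
                         (proj₂ (∈-fromDec⁺ (final₂ q ≟ᵇ true ×-dec decode c ≟ₘ diag₁ (- n)) _ (final , c≡diag₁-)))) ,
      inverse (φ (N ∷ [])) (trans (cong (_· diag₁ n) φ-[ N ]) (trans (φN·diag₁ n) (sym c≡diag₁-)))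
      where
      c≡diag₁- : decode c ≡ diag₁ (- n)
      c≡diag₁- = trans shape upper≡diag₁-

  complete : Solution → WordPath (first s₁) I₂ done
  complete (w₁ , w₂ , accepts₁ , accepts₂ , solution) =
    WordPath-subst label≡ (first-path s₁ w₁ ◅◅ (start-edge ◅ (path₂ ◅◅ (proj₁ (proj₂ closing) ◅ ε))))
    where
    open ≡-Reasoning
    start-edge : ([] , second s₂ (proj₁ diag₁-code)) ∈ edges (first (run A₁ s₁ w₁))
    start-edge = ∈-++⁺ʳ (map (letterEdge (run A₁ s₁ w₁)) letters) (proj₂ (∈-fromDec⁺ (final₁ _ ≟ᵇ true) _ accepts₁))
    phase₂ : Σ Code λ c → Σ Mat2 λ h → WordPath (second s₂ (proj₁ diag₁-code)) h (second (run A₂ s₂ w₂) c) ×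
               decode (proj₁ diag₁-code) · φ w₂ ≡ h · decode c × Tracked c
    phase₂ = second-path s₂ w₂ (proj₁ diag₁-code) tracked₀
    c : Code
    c = proj₁ phase₂
    h : Mat2
    h = proj₁ (proj₂ phase₂)
    path₂ : WordPath (second s₂ (proj₁ diag₁-code)) h (second (run A₂ s₂ w₂) c)
    path₂ = proj₁ (proj₂ (proj₂ phase₂))
    G·c≡diag₁ : φ w₁ · h · decode c ≡ diag₁ n
    G·c≡diag₁ = begin
      φ w₁ · h · decode c                       ≡⟨ ·-assoc (φ w₁) h (decode c) ⟩
      φ w₁ · (h · decode c)                     ≡⟨ cong (φ w₁ ·_) (proj₁ (proj₂ (proj₂ (proj₂ phase₂)))) ⟨
      φ w₁ · (decode (proj₁ diag₁-code) · φ w₂) ≡⟨ cong (λ D → φ w₁ · (D · φ w₂)) (proj₂ diag₁-code) ⟩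
      φ w₁ · (diag₁ n · φ w₂)                   ≡⟨ ·-assoc (φ w₁) (diag₁ n) (φ w₂) ⟨
      φ w₁ · diag₁ n · φ w₂                     ≡⟨ solution ⟩
      diag₁ n                                   ∎
    closing : Σ (List Letter) λ k → (k , done) ∈ edges (second (run A₂ s₂ w₂) c) × φ w₁ · h · φ k ≡ I₂
    closing = closing-edge accepts₂ (proj₂ (proj₂ (proj₂ (proj₂ phase₂))))
                (subst Unit (sym (det-· (φ w₁) h)) (Unit-* (Unit-det-φ w₁) (WordPath-Unit path₂))) G·c≡diag₁
    k : List Letter
    k = proj₁ closing
    label≡ : φ w₁ · (I₂ · (h · (φ k · I₂))) ≡ I₂
    label≡ = begin
      φ w₁ · (I₂ · (h · (φ k · I₂)))    ≡⟨ cong (λ M → φ w₁ · M) (trans (·-identityˡ _) (cong (h ·_) (·-identityʳ (φ k)))) ⟩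
      φ w₁ · (h · φ k)                  ≡⟨ ·-assoc (φ w₁) h (φ k) ⟨
      φ w₁ · h · φ k                    ≡⟨ proj₂ (proj₂ closing) ⟩
      I₂                                ∎

  solution? : Dec Solution
  solution? with identityWordPath? (first s₁) done
  ... | yes path = yes (sound path)
  ... | no ¬path = no λ solution → ¬path (complete solution)

proposition4 : (m n : ℤ) → m ≢ 0ℤ → n ≢ 0ℤ → (A₁ A₂ : DFA) →
    Dec (Σ Mat2 (λ M₁ → Σ Mat2 (λ M₂ →
    M₁ ∈φL A₁ × M₂ ∈φL A₂ × M₁ ⊗ diagSNF m n ⊗ M₂ ≡ diagSNF m n)))
proposition4 m n m≢0 n≢0 A₁ A₂ = map′ matrices words solution?
  where
  open Reduction n n≢0 A₁ A₂ using (Solution; solution?)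
  open Equivalence
  matrices : Solution → Σ Mat2 λ M₁ → Σ Mat2 λ M₂ → M₁ ∈φL A₁ × M₂ ∈φL A₂ × M₁ ⊗ diagSNF m n ⊗ M₂ ≡ diagSNF m n
  matrices (w₁ , w₂ , accepts₁ , accepts₂ , solution) =
    φ w₁ , φ w₂ , (w₁ , accepts₁ , refl) , (w₂ , accepts₂ , refl) , from (diagSNF-equation⇔ n m≢0 (φ w₁) (φ w₂)) solution
  words : (Σ Mat2 λ M₁ → Σ Mat2 λ M₂ → M₁ ∈φL A₁ × M₂ ∈φL A₂ × M₁ ⊗ diagSNF m n ⊗ M₂ ≡ diagSNF m n) → Solution
  words (_ , _ , (w₁ , accepts₁ , refl) , (w₂ , accepts₂ , refl) , equation) =
    w₁ , w₂ , accepts₁ , accepts₂ , to (diagSNF-equation⇔ n m≢0 (φ w₁) (φ w₂)) equation
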